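{- Let $G$ be a finite simple graph of order $2n$ that has a perfect matching, and suppose $f(G)=k$ where $0\leq k\leq n-1$. Then $$e(G)\leq n^2+2nk-k^2-k,$$ and equality holds if and only if $G$ is isomorphic to $\hat{H}_{n-k,0}\vee K_{2k}$.
   Context: For a graph $G$ with a perfect matching $M$, a subset $S\subseteq M$ is a forcing set of $M$ if $S$ is contained in no perfect matching of $G$ other than $M$. The forcing number $f(G,M)$ is the minimum size of a forcing set of $M$, and the minimum forcing number is $f(G)=\min_M f(G,M)$ over all perfect matchings $M$ of $G$. $e(G)$ denotes the number of edges. For $m\geq 1$, $H_{m,0}$ is the bipartite graph with parts $U=\{u_1,\dots,u_m\}$, $V=\{v_1,\dots,v_m\}$ in which $u_iv_j$ is an edge if and only if $i\geq j$; $\hat{H}_{m,0}$ is obtained from $H_{m,0}$ by adding all edges between pairs of vertices of $V$. $K_{2k}$ is the complete graph on $2k$ vertices ($K_0$ is the empty graph). The join $G\vee H$ is the disjoint union of $G$ and $H$ together with all edges $xy$, $x\in V(G)$, $y\in V(H)$. -}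

module Defs where

open import Data.Nat using (ℕ; zero; suc; _+_; _*_; _∸_; _≤_; _<_; _≤ᵇ_; _<ᵇ_)
open import Data.Bool using (Bool; true; false; _∧_; not; if_then_else_)
open import Data.Fin using (Fin; toℕ; splitAt; _↑ˡ_; _↑ʳ_)
open import Data.Fin.Properties using (_≟_)
open import Data.Sum using (_⊎_; inj₁; inj₂)
open import Data.Product using (Σ; _×_; _,_; ∃)
open import Data.List using (List; map; allFin)
open import Data.Nat.ListAction using (sum)
open import Relation.Nullary using (¬_)
open import Relation.Nullary.Decidable using (⌊_⌋)
open import Relation.Binary.PropositionalEquality using (_≡_; refl; sym; cong)
open import Function.Bundles using (Bijection)

record Graph (m : ℕ) : Set where
  field
    adj    : Fin m → Fin m → Bool
    adj-sym    : ∀ i j → adj i j ≡ adj j i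
    adj-irrefl : ∀ i → adj i i ≡ false
open Graph public

EdgeSet : ℕ → Set
EdgeSet m = Fin m → Fin m → Bool

countPairs : ∀ {m} → EdgeSet m → ℕ
countPairs {m} E =
  sum (map (λ i → sum (map (λ j → if (toℕ i <ᵇ toℕ j) ∧ E i j then 1 else 0)
                           (allFin m)))
           (allFin m))

e : ∀ {m} → Graph m → ℕ
e G = countPairs (adj G)

-- Perfect matchings, represented by the partner map μ : every vertex i is
-- matched to μ i; μ is a fixed-point-free involution along edges of G.
-- The edge set of the matching is {{i, μ i}}.

record PerfectMatching {m : ℕ} (G : Graph m) : Set where
  field
    mate      : Fin m → Fin m
    mate-inv  : ∀ i → mate (mate i) ≡ i
    mate-adj  : ∀ i → adj G i (mate i) ≡ true
open PerfectMatching public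
-- (fixed-point-freeness follows from mate-adj and irreflexivity)

HasPerfectMatching : ∀ {m} → Graph m → Set
HasPerfectMatching G = PerfectMatching G

InMatching : ∀ {m} {G : Graph m} → PerfectMatching G → Fin m → Fin m → Set
InMatching M i j = mate M i ≡ j

SameMatching : ∀ {m} {G : Graph m} → PerfectMatching G → PerfectMatching G → Set
SameMatching {m} M M' = ∀ (i : Fin m) → mate M i ≡ mate M' i

SubsetOfMatching : ∀ {m} {G : Graph m} → EdgeSet m → PerfectMatching G → Set
SubsetOfMatching {m} S M =
  (∀ (i j : Fin m) → S i j ≡ S j i) ×
  (∀ (i j : Fin m) → S i j ≡ true → InMatching M i j)

IsForcingSet : ∀ {m} {G : Graph m} → EdgeSet m → PerfectMatching G → Set
IsForcingSet {G = G} S M =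
  SubsetOfMatching S M ×
  (∀ (M' : PerfectMatching G) → SubsetOfMatching S M' → SameMatching M' M)

-- f(G) = k : some perfect matching has a forcing set of size k, and every
-- forcing set of every perfect matching has size ≥ k.
-- (This is exactly k = min_M min{ |S| : S forcing set of M }.)
MinForcingNumber : ∀ {m} → Graph m → ℕ → Set
MinForcingNumber G k =
  (Σ (PerfectMatching G) λ M → Σ (EdgeSet _) λ S →
      IsForcingSet S M × countPairs S ≡ k) ×
  (∀ (M : PerfectMatching G) (S : EdgeSet _) → IsForcingSet S M → k ≤ countPairs S)

_≅_ : ∀ {m m'} → Graph m → Graph m' → Set
_≅_ {m} {m'} G H =
  Σ (Bijection (≡-setoid (Fin m)) (≡-setoid (Fin m'))) λ f →
    ∀ i j → adj G i j ≡ adj H (Bijection.to f i) (Bijection.to f j)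
  where open import Relation.Binary.PropositionalEquality using () renaming (setoid to ≡-setoid)

neq : ∀ {m} → Fin m → Fin m → Bool
neq i j = not ⌊ i ≟ j ⌋

neq-sym : ∀ {m} (i j : Fin m) → neq i j ≡ neq j i
neq-sym i j with i ≟ j | j ≟ i
... | Relation.Nullary.yes _ | Relation.Nullary.yes _ = refl
... | Relation.Nullary.no _  | Relation.Nullary.no _  = refl
... | Relation.Nullary.yes p | Relation.Nullary.no q  = Data.Empty.⊥-elim (q (sym p))
  where import Data.Empty
... | Relation.Nullary.no p  | Relation.Nullary.yes q = Data.Empty.⊥-elim (p (sym q))
  where import Data.Empty

neq-irrefl : ∀ {m} (i : Fin m) → neq i i ≡ false
neq-irrefl i with i ≟ i
... | Relation.Nullary.yes _ = refl
... | Relation.Nullary.no p  = Data.Empty.⊥-elim (p refl)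
  where import Data.Empty

complete : (m : ℕ) → Graph m
complete m = record { adj = neq ; adj-sym = neq-sym ; adj-irrefl = neq-irrefl }

-- Ĥ_{p,0} on Fin (p + p): u_i = i ↑ˡ p (part U), v_j = p ↑ʳ j (part V).
-- u_i v_j is an edge iff i ≥ j; V is a clique; U is independent.
hatH-adj : (p : ℕ) → Fin (p + p) → Fin (p + p) → Bool
hatH-adj p x y with splitAt p x | splitAt p y
... | inj₁ i | inj₁ j = false
... | inj₁ i | inj₂ j = toℕ j ≤ᵇ toℕ i
... | inj₂ i | inj₁ j = toℕ i ≤ᵇ toℕ j
... | inj₂ i | inj₂ j = neq i j

hatH-sym : (p : ℕ) → ∀ x y → hatH-adj p x y ≡ hatH-adj p y x
hatH-sym p x y with splitAt p x | splitAt p y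
... | inj₁ i | inj₁ j = refl
... | inj₁ i | inj₂ j = refl
... | inj₂ i | inj₁ j = refl
... | inj₂ i | inj₂ j = neq-sym i j

hatH-irrefl : (p : ℕ) → ∀ x → hatH-adj p x x ≡ false
hatH-irrefl p x with splitAt p x
... | inj₁ i = refl
... | inj₂ i = neq-irrefl i

hatH : (p : ℕ) → Graph (p + p)
hatH p = record { adj = hatH-adj p ; adj-sym = hatH-sym p ; adj-irrefl = hatH-irrefl p }

join-adj : ∀ {a b} → Graph a → Graph b → Fin (a + b) → Fin (a + b) → Bool
join-adj {a} G H x y with splitAt a x | splitAt a y
... | inj₁ i | inj₁ j = adj G i j
... | inj₁ i | inj₂ j = true
... | inj₂ i | inj₁ j = true
... | inj₂ i | inj₂ j = adj H i j

join-sym : ∀ {a b} (G : Graph a) (H : Graph b) x y → join-adj G H x y ≡ join-adj G H y x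
join-sym {a} G H x y with splitAt a x | splitAt a y
... | inj₁ i | inj₁ j = Graph.adj-sym G i j
... | inj₁ i | inj₂ j = refl
... | inj₂ i | inj₁ j = refl
... | inj₂ i | inj₂ j = Graph.adj-sym H i j

join-irrefl : ∀ {a b} (G : Graph a) (H : Graph b) x → join-adj G H x x ≡ false
join-irrefl {a} G H x with splitAt a x
... | inj₁ i = Graph.adj-irrefl G i
... | inj₂ i = Graph.adj-irrefl H i

_∨ᵍ_ : ∀ {a b} → Graph a → Graph b → Graph (a + b)
G ∨ᵍ H = record { adj = join-adj G H ; adj-sym = join-sym G H ; adj-irrefl = join-irrefl G H }

extremal : (n k : ℕ) → Graph ((n ∸ k) + (n ∸ k) + 2 * k)
extremal n k = hatH (n ∸ k) ∨ᵍ complete (2 * k)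

-- Fix a perfect matching M (partner map μ) with a forcing set S of size k, and call the
-- 2p = 2n - 2k vertices not covered by S uncovered.  For uncovered x, a with a ∉ {x, μ x},
-- xa and (μ x)(μ a) are not both edges: switching M along the 4-cycle x a μa μx would give a
-- second perfect matching containing S.  Summing A x a + A (μ x) (μ a) over all ordered pairs
-- therefore gives 4 e(G) ≤ 2 · 2n(2n - 1) - 2p(2p - 2), which is the bound.
--
-- If equality holds, every covered vertex is adjacent to all others, and for every such pair
-- exactly one of the two edges is present.  Ruling out alternating 6-cycles as well, the relation
-- "z is adjacent to both ends of the matching edge {x, μ x}" orders the p uncovered matching
-- edges linearly; numbering them along this order identifies G with Ĥ_{p,0} ∨ K_{2k}.

module Submission where

open import Defs
open import Algebra.Properties.Semiring.Sum as Sum using ()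
open import Data.Bool using (Bool; true; false; _∧_; not; if_then_else_)
open import Data.Bool.Properties using (not-involutive; ∧-identityʳ; ⇔→≡; T-≡)
open import Data.Empty using (⊥; ⊥-elim)
open import Data.Fin using (Fin; zero; suc; toℕ; fromℕ<; splitAt; join; _↑ˡ_; _↑ʳ_; punchOut)
open import Data.Fin.Permutation using (Permutation; permutation)
open import Data.Fin.Permutation.Components using (transpose)
open import Data.Fin.Properties
  using (_≟_; toℕ-injective; toℕ-fromℕ<; toℕ<n; toℕ-↑ˡ; toℕ-↑ʳ; splitAt-↑ˡ; splitAt-↑ʳ; join-splitAt;
         any?; pigeonhole; punchOut-injective; suc-injective)
open import Data.List using (allFin; tabulate) renaming (map to mapᴸ)
open import Data.List.Properties using (map-tabulate)
open import Data.Nat using (ℕ; zero; suc; _+_; _*_; _∸_; _≤_; _<_; _≤ᵇ_; _<ᵇ_; _≡ᵇ_; z≤n; s≤s)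
open import Data.Nat.ListAction using () renaming (sum to sumᴸ)
open import Data.Nat.Properties hiding (_≟_; suc-injective)
open import Data.Nat.Properties using () renaming (_≟_ to _≟ℕ_)
open import Data.Nat.Tactic.RingSolver using (solve-∀)
open import Data.Product using (_×_; _,_; proj₁; proj₂; ∃)
open import Data.Sum using (_⊎_; inj₁; inj₂)
open import Function.Bundles using (_⇔_; mk⇔; Bijection; Equivalence)
open import Relation.Binary.Definitions using (tri<; tri≈; tri>)
open import Relation.Binary.PropositionalEquality
open import Relation.Nullary using (¬_; Dec; yes; no)
open import Relation.Nullary.Decidable using (does; ⌊_⌋; dec-true; dec-false; isYes≗does)

open Sum +-*-semiring using (sum; sum-syntax; sum-cong-≗; ∑-distrib-+; ∑-comm; ∑-permute; *-distribˡ-sum)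

χ : Bool → ℕ
χ true  = 1
χ false = 0

χ≤1 : ∀ b → χ b ≤ 1
χ≤1 true  = s≤s z≤n
χ≤1 false = z≤n

χ-not+χ : ∀ b → χ (not b) + χ b ≡ 1
χ-not+χ true  = refl
χ-not+χ false = refl

nots-true⇒falses : ∀ b₁ b₂ b₃ b₄ → not b₁ ∧ not b₂ ∧ not b₃ ∧ not b₄ ≡ true →
                   b₁ ≡ false × b₂ ≡ false × b₃ ≡ false × b₄ ≡ false
nots-true⇒falses false false false false _ = refl , refl , refl , refl

χ+χ≤1 : ∀ a b → (a ≡ true → b ≡ true → ⊥) → χ a + χ b ≤ 1
χ+χ≤1 true  true  a∧b = ⊥-elim (a∧b refl refl)
χ+χ≤1 true  false _   = s≤s z≤n
χ+χ≤1 false b     _   = χ≤1 b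

χ+χ≤χ : ∀ a b c → (a ≡ true → c ≡ true) → (b ≡ true → c ≡ true) → (a ≡ true → b ≡ true → ⊥) →
        χ a + χ b ≤ χ c
χ+χ≤χ true  true  c a⇒c b⇒c a∧b = ⊥-elim (a∧b refl refl)
χ+χ≤χ true  false c a⇒c b⇒c a∧b rewrite a⇒c refl = s≤s z≤n
χ+χ≤χ false true  c a⇒c b⇒c a∧b rewrite b⇒c refl = s≤s z≤n
χ+χ≤χ false false c a⇒c b⇒c a∧b = z≤n

χ+χ≡2 : ∀ a b → χ a + χ b ≡ 2 → a ≡ true
χ+χ≡2 true  _     _ = refl
χ+χ≡2 false true  ()
χ+χ≡2 false false ()

χ+χ≡1 : ∀ a b → χ a + χ b ≡ 1 → b ≡ not a
χ+χ≡1 true  false _ = refl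
χ+χ≡1 false true  _ = refl
χ+χ≡1 true  true  ()
χ+χ≡1 false false ()

true≢false : ∀ {b} → b ≡ true → b ≡ false → ⊥
true≢false refl ()

∧-trueˡ : ∀ {a b} → a ∧ b ≡ true → a ≡ true
∧-trueˡ {true} _ = refl

∧-trueʳ : ∀ {a b} → a ∧ b ≡ true → b ≡ true
∧-trueʳ {true} a∧b = a∧b

⇒∧-true : ∀ {a b} → a ≡ true → b ≡ true → a ∧ b ≡ true
⇒∧-true refl refl = refl

∧₃-true⇒ : ∀ {a b c} → a ∧ b ∧ c ≡ true → a ≡ true × b ≡ true × c ≡ true
∧₃-true⇒ {true} {true} {true} _ = refl , refl , refl

⇒∧₃-true : ∀ {a b c} → a ≡ true → b ≡ true → c ≡ true → a ∧ b ∧ c ≡ true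
⇒∧₃-true refl refl refl = refl

does-true⇒ : ∀ {P : Set} (P? : Dec P) → does P? ≡ true → P
does-true⇒ (yes p) _ = p

does-false⇒¬ : ∀ {P : Set} (P? : Dec P) → does P? ≡ false → ¬ P
does-false⇒¬ (no ¬p) _ = ¬p

χ-positive : ∀ b → 0 < χ b → b ≡ true
χ-positive true _ = refl

<ᵇ-true : ∀ {a b} → a < b → (a <ᵇ b) ≡ true
<ᵇ-true = dec-true (_ <? _)

<ᵇ-false : ∀ {a b} → b ≤ a → (a <ᵇ b) ≡ false
<ᵇ-false b≤a = dec-false (_ <? _) (≤⇒≯ b≤a)

<ᵇ-true⇒< : ∀ {a b} → (a <ᵇ b) ≡ true → a < b
<ᵇ-true⇒< {a} {b} a<ᵇb = <ᵇ⇒< a b (Equivalence.from T-≡ a<ᵇb)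

≤ᵇ-true : ∀ {a b} → a ≤ b → (a ≤ᵇ b) ≡ true
≤ᵇ-true = dec-true (_ ≤? _)

≤ᵇ-false : ∀ {a b} → b < a → (a ≤ᵇ b) ≡ false
≤ᵇ-false b<a = dec-false (_ ≤? _) (<⇒≱ b<a)

≡ᵇ-refl : ∀ a → (a ≡ᵇ a) ≡ true
≡ᵇ-refl a = dec-true (a ≟ℕ a) refl

≡ᵇ-sym : ∀ a b → (a ≡ᵇ b) ≡ (b ≡ᵇ a)
≡ᵇ-sym zero    zero    = refl
≡ᵇ-sym zero    (suc b) = refl
≡ᵇ-sym (suc a) zero    = refl
≡ᵇ-sym (suc a) (suc b) = ≡ᵇ-sym a b

≡ᵇ-+ : ∀ p a b → (p + a ≡ᵇ p + b) ≡ (a ≡ᵇ b)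
≡ᵇ-+ zero    a b = refl
≡ᵇ-+ (suc p) a b = ≡ᵇ-+ p a b

≡ᵇ-false : ∀ {a b} → a ≢ b → (a ≡ᵇ b) ≡ false
≡ᵇ-false = dec-false (_ ≟ℕ _)

∑-const : ∀ n c → ∑[ i < n ] c ≡ n * c
∑-const zero    c = refl
∑-const (suc n) c = cong (c +_) (∑-const n c)

∑-mono-≤ : ∀ {n} {f g : Fin n → ℕ} → (∀ i → f i ≤ g i) → sum f ≤ sum g
∑-mono-≤ {zero}  f≤g = z≤n
∑-mono-≤ {suc n} f≤g = +-mono-≤ (f≤g zero) (∑-mono-≤ (λ i → f≤g (suc i)))

∑-mono-≤-tight : ∀ {n} {f g : Fin n → ℕ} → (∀ i → f i ≤ g i) → sum g ≤ sum f → ∀ i → f i ≡ g i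
∑-mono-≤-tight {suc n} {f} {g} f≤g ∑g≤∑f = go
  where
  head-and-tail : f zero ≡ g zero × sum (λ i → f (suc i)) ≡ sum (λ i → g (suc i))
  head-and-tail with m≤n⇒m<n∨m≡n (f≤g zero)
  ... | inj₂ f₀≡g₀ rewrite f₀≡g₀ =
    refl , ≤-antisym (∑-mono-≤ (λ i → f≤g (suc i))) (+-cancelˡ-≤ (g zero) _ _ ∑g≤∑f)
  ... | inj₁ f₀<g₀ = ⊥-elim (<⇒≱ (+-mono-<-≤ f₀<g₀ (∑-mono-≤ (λ i → f≤g (suc i)))) ∑g≤∑f)
  go : ∀ i → f i ≡ g i
  go zero    = proj₁ head-and-tail
  go (suc i) = ∑-mono-≤-tight (λ j → f≤g (suc j)) (≤-reflexive (sym (proj₂ head-and-tail))) i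

∑-single : ∀ {n} {f : Fin n → ℕ} a → (∀ j → j ≢ a → f j ≡ 0) → sum f ≡ f a
∑-single {suc n} {f} zero others = begin
  f zero + sum (λ i → f (suc i)) ≡⟨ cong (f zero +_) (∑-cong-zero (λ i → others (suc i) λ ())) ⟩
  f zero + 0                     ≡⟨ +-identityʳ (f zero) ⟩
  f zero                         ∎
  where
  open ≡-Reasoning
  ∑-cong-zero : ∀ {n} {h : Fin n → ℕ} → (∀ i → h i ≡ 0) → sum h ≡ 0
  ∑-cong-zero {n} h≡0 = trans (sum-cong-≗ h≡0) (trans (∑-const n 0) (*-zeroʳ n))
∑-single {suc n} {f} (suc a) others =
  cong₂ _+_ (others zero λ ()) (∑-single a (λ j j≢a → others (suc j) (λ eq → j≢a (suc-injective eq))))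

term≤∑ : ∀ {n} (f : Fin n → ℕ) a → f a ≤ sum f
term≤∑ f zero    = m≤m+n (f zero) _
term≤∑ f (suc a) = ≤-trans (term≤∑ (λ i → f (suc i)) a) (m≤n+m _ (f zero))

∑-positive : ∀ {n} (f : Fin n → ℕ) → 0 < sum f → ∃ λ i → 0 < f i
∑-positive {suc n} f ∑>0 with f zero in f₀≡
... | suc _ = zero , subst (0 <_) (sym f₀≡) (s≤s z≤n)
... | zero with ∑-positive (λ i → f (suc i)) ∑>0
...   | i , fi>0 = suc i , fi>0

∑-splitAt : ∀ a b (f : Fin (a + b) → ℕ) → sum f ≡ ∑[ i < a ] f (i ↑ˡ b) + ∑[ j < b ] f (a ↑ʳ j)
∑-splitAt zero    b f = refl
∑-splitAt (suc a) b f rewrite ∑-splitAt a b (λ i → f (suc i)) = sym (+-assoc (f zero) _ _)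

∑∑-distrib-+ : ∀ {a b} (f g : Fin a → Fin b → ℕ) →
  ∑[ i < a ] ∑[ j < b ] (f i j + g i j) ≡ ∑[ i < a ] ∑[ j < b ] f i j + ∑[ i < a ] ∑[ j < b ] g i j
∑∑-distrib-+ {a} {b} f g =
  trans (sum-cong-≗ (λ i → ∑-distrib-+ (f i) (g i))) (∑-distrib-+ (λ i → ∑[ j < b ] f i j) (λ i → ∑[ j < b ] g i j))

∑∑χ-cong : ∀ {a b} {E F : Fin a → Fin b → Bool} → (∀ i j → E i j ≡ F i j) →
           ∑[ i < a ] ∑[ j < b ] χ (E i j) ≡ ∑[ i < a ] ∑[ j < b ] χ (F i j)
∑∑χ-cong E≡F = sum-cong-≗ (λ i → sum-cong-≗ (λ j → cong χ (E≡F i j)))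

∑-χ-≡ : ∀ {n} (x : Fin n) → ∑[ a < n ] χ (does (a ≟ x)) ≡ 1
∑-χ-≡ x = trans (∑-single x (λ a a≢x → cong χ (dec-false (a ≟ x) a≢x))) (cong χ (dec-true (x ≟ x) refl))

∑-χ-≢ : ∀ {n} (x : Fin n) → ∑[ a < n ] χ (not (does (a ≟ x))) + 1 ≡ n
∑-χ-≢ {n} x = begin
  ∑[ a < n ] χ (not (does (a ≟ x))) + 1
    ≡⟨ cong (∑[ a < n ] χ (not (does (a ≟ x))) +_) (sym (∑-χ-≡ x)) ⟩
  ∑[ a < n ] χ (not (does (a ≟ x))) + ∑[ a < n ] χ (does (a ≟ x))
    ≡⟨ sym (∑-distrib-+ (λ a → χ (not (does (a ≟ x)))) (λ a → χ (does (a ≟ x)))) ⟩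
  ∑[ a < n ] (χ (not (does (a ≟ x))) + χ (does (a ≟ x)))
    ≡⟨ sum-cong-≗ (λ a → χ-not+χ (does (a ≟ x))) ⟩
  ∑[ a < n ] 1
    ≡⟨ trans (∑-const n 1) (*-identityʳ n) ⟩
  n ∎
  where open ≡-Reasoning

sumᴸ-allFin : ∀ n (f : Fin n → ℕ) → sumᴸ (mapᴸ f (allFin n)) ≡ sum f
sumᴸ-allFin zero    f = refl
sumᴸ-allFin (suc n) f = cong (f zero +_) (begin
  sumᴸ (mapᴸ f (tabulate suc))                ≡⟨ cong sumᴸ (map-tabulate suc f) ⟩
  sumᴸ (tabulate (λ i → f (suc i)))           ≡⟨ cong sumᴸ (sym (map-tabulate (λ i → i) (λ i → f (suc i)))) ⟩
  sumᴸ (mapᴸ (λ i → f (suc i)) (allFin n))    ≡⟨ sumᴸ-allFin n (λ i → f (suc i)) ⟩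
  sum (λ i → f (suc i))                       ∎)
  where open ≡-Reasoning

orderedPairs : ∀ {m} → EdgeSet m → ℕ
orderedPairs {m} E = ∑[ i < m ] ∑[ j < m ] χ (E i j)

Symmetric Irreflexive : ∀ {m} → EdgeSet m → Set
Symmetric   E = ∀ i j → E i j ≡ E j i
Irreflexive E = ∀ i → E i i ≡ false

module _ {m} (E : EdgeSet m) where

  private
    _≺_ : Fin m → Fin m → Bool
    i ≺ j = toℕ i <ᵇ toℕ j

  countPairs≡∑ : countPairs E ≡ ∑[ i < m ] ∑[ j < m ] χ (i ≺ j ∧ E i j)
  countPairs≡∑ = trans (sumᴸ-allFin m _)
    (sum-cong-≗ (λ i → trans (sumᴸ-allFin m _) (sum-cong-≗ (λ j → if-χ (i ≺ j ∧ E i j)))))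
    where
    if-χ : ∀ b → (if b then 1 else 0) ≡ χ b
    if-χ true  = refl
    if-χ false = refl

  orderedPairs≡2*countPairs : Symmetric E → Irreflexive E → orderedPairs E ≡ 2 * countPairs E
  orderedPairs≡2*countPairs sym-E irr-E = begin
    orderedPairs E
      ≡⟨ sum-cong-≗ (λ i → sum-cong-≗ (split i)) ⟩
    ∑[ i < m ] ∑[ j < m ] (below i j + above j i)
      ≡⟨ ∑∑-distrib-+ below (λ i j → above j i) ⟩
    ∑[ i < m ] sum (below i) + ∑[ i < m ] ∑[ j < m ] above j i
      ≡⟨ cong (∑[ i < m ] sum (below i) +_) (∑-comm (λ i j → above j i)) ⟩
    ∑[ i < m ] sum (below i) + ∑[ j < m ] sum (below j)
      ≡⟨ cong (λ c → c + c) (sym countPairs≡∑) ⟩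
    countPairs E + countPairs E
      ≡⟨ cong (countPairs E +_) (sym (+-identityʳ _)) ⟩
    2 * countPairs E ∎
    where
    open ≡-Reasoning
    below above : Fin m → Fin m → ℕ
    below i j = χ (i ≺ j ∧ E i j)
    above j i = χ (j ≺ i ∧ E j i)
    split : ∀ i j → χ (E i j) ≡ below i j + above j i
    split i j with <-cmp (toℕ i) (toℕ j)
    ... | tri< i<j _ _ rewrite <ᵇ-true i<j | <ᵇ-false (<⇒≤ i<j) = sym (+-identityʳ _)
    ... | tri> _ _ i>j rewrite <ᵇ-false (<⇒≤ i>j) | <ᵇ-true i>j | sym-E i j = refl
    ... | tri≈ _ i≡j _ rewrite toℕ-injective i≡j | irr-E j | <ᵇ-false (≤-refl {toℕ j}) = refl

orderedPairs-adj : ∀ {m} (G : Graph m) → orderedPairs (adj G) ≡ 2 * e G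
orderedPairs-adj G = orderedPairs≡2*countPairs (adj G) (adj-sym G) (adj-irrefl G)

≅⇒e≡ : ∀ {m m'} (G : Graph m) (H : Graph m') → G ≅ H → e G ≡ e H
≅⇒e≡ {m} {m'} G H (f , f-adj) = *-cancelˡ-≡ _ _ 2 (begin
  2 * e G                                          ≡⟨ sym (orderedPairs-adj G) ⟩
  orderedPairs (adj G)                             ≡⟨ ∑∑χ-cong f-adj ⟩
  ∑[ i < m ] ∑[ j < m ] χ (adj H (to i) (to j))   ≡⟨ sum-cong-≗ (λ i → sym (∑-permute (λ j → χ (adj H (to i) j)) π)) ⟩
  ∑[ i < m ] ∑[ j < m' ] χ (adj H (to i) j)        ≡⟨ sym (∑-permute (λ i → ∑[ j < m' ] χ (adj H i j)) π) ⟩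
  orderedPairs (adj H)                             ≡⟨ orderedPairs-adj H ⟩
  2 * e H                                          ∎)
  where
  open ≡-Reasoning
  to = Bijection.to f
  from : Fin m' → Fin m
  from y = proj₁ (Bijection.surjective f y)
  to-from : ∀ y → to (from y) ≡ y
  to-from y = proj₂ (Bijection.surjective f y) refl
  π : Permutation m m'
  π = permutation to from to-from (λ x → Bijection.injective f (to-from (to x)))

module _ {m} (i j : Fin m) where

  transpose-i : transpose i j i ≡ j
  transpose-i rewrite dec-true (i ≟ i) refl = refl

  transpose-j : transpose i j j ≡ i
  transpose-j with j ≟ i
  ... | yes refl = refl
  ... | no _ rewrite dec-true (j ≟ j) refl = refl

  transpose-other : ∀ {k} → k ≢ i → k ≢ j → transpose i j k ≡ k
  transpose-other {k} k≢i k≢j rewrite dec-false (k ≟ i) k≢i | dec-false (k ≟ j) k≢j = refl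

  transpose-involutive : ∀ k → transpose i j (transpose i j k) ≡ k
  transpose-involutive k = by-cases (k ≟ i) (k ≟ j)
    where
    by-cases : Dec (k ≡ i) → Dec (k ≡ j) → transpose i j (transpose i j k) ≡ k
    by-cases (yes refl) _          = trans (cong (transpose i j) transpose-i) transpose-j
    by-cases (no _)     (yes refl) = trans (cong (transpose i j) transpose-j) transpose-i
    by-cases (no k≢i)   (no k≢j)   =
      trans (cong (transpose i j) (transpose-other k≢i k≢j)) (transpose-other k≢i k≢j)

  conjugate : (Fin m → Fin m) → Fin m → Fin m
  conjugate f k = transpose i j (f (transpose i j k))

  conjugate-involutive : ∀ f → (∀ k → f (f k) ≡ k) → ∀ k → conjugate f (conjugate f k) ≡ k
  conjugate-involutive f f-inv k = begin
    transpose i j (f (transpose i j (transpose i j (f (transpose i j k)))))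
      ≡⟨ cong (λ l → transpose i j (f l)) (transpose-involutive (f (transpose i j k))) ⟩
    transpose i j (f (f (transpose i j k)))  ≡⟨ cong (transpose i j) (f-inv (transpose i j k)) ⟩
    transpose i j (transpose i j k)          ≡⟨ transpose-involutive k ⟩
    k                                        ∎
    where open ≡-Reasoning

  conjugate-other : ∀ f {k} → k ≢ i → k ≢ j → f k ≢ i → f k ≢ j → conjugate f k ≡ f k
  conjugate-other f k≢i k≢j fk≢i fk≢j =
    trans (cong (λ l → transpose i j (f l)) (transpose-other k≢i k≢j)) (transpose-other fk≢i fk≢j)

-- Q = (2p)² − 2·2p and D = (2(p + k))² − 2(p + k), stated without truncated subtraction.
module _ (e p k D Q : ℕ)
         (Q-def : Q + 2 * (2 * p) ≡ (2 * p) * (2 * p))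
         (D-def : D + 2 * (p + k) ≡ (2 * (p + k)) * (2 * (p + k))) where

  private
    K X : ℕ
    K = 2 * (2 * p) + 2 * (2 * (p + k)) + 4 * (k * k)
    X = 4 * (p * p) + 4 * p

    lhs-identity : 4 * e + Q + K ≡ 4 * (e + (k * k + k)) + X
    lhs-identity = begin
      4 * e + Q + K                                                        ≡⟨ regroup e p k Q ⟩
      (Q + 2 * (2 * p)) + (4 * e + 2 * (2 * (p + k)) + 4 * (k * k))        ≡⟨ cong (_+ (4 * e + 2 * (2 * (p + k)) + 4 * (k * k))) Q-def ⟩
      (2 * p) * (2 * p) + (4 * e + 2 * (2 * (p + k)) + 4 * (k * k))        ≡⟨ expand e p k ⟩
      4 * (e + (k * k + k)) + X                                            ∎
      where
      open ≡-Reasoning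
      regroup : ∀ e p k Q → 4 * e + Q + (2 * (2 * p) + 2 * (2 * (p + k)) + 4 * (k * k))
                          ≡ (Q + 2 * (2 * p)) + (4 * e + 2 * (2 * (p + k)) + 4 * (k * k))
      regroup = solve-∀
      expand : ∀ e p k → (2 * p) * (2 * p) + (4 * e + 2 * (2 * (p + k)) + 4 * (k * k))
                       ≡ 4 * (e + (k * k + k)) + (4 * (p * p) + 4 * p)
      expand = solve-∀

    rhs-identity : 2 * D + K ≡ 4 * ((p + k) * (p + k) + 2 * (p + k) * k) + X
    rhs-identity = begin
      2 * D + K                                                            ≡⟨ regroup D p k ⟩
      2 * (D + 2 * (p + k)) + (2 * (2 * p) + 4 * (k * k))                  ≡⟨ cong (λ d → 2 * d + (2 * (2 * p) + 4 * (k * k))) D-def ⟩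
      2 * ((2 * (p + k)) * (2 * (p + k))) + (2 * (2 * p) + 4 * (k * k))    ≡⟨ expand p k ⟩
      4 * ((p + k) * (p + k) + 2 * (p + k) * k) + X                        ∎
      where
      open ≡-Reasoning
      regroup : ∀ D p k → 2 * D + (2 * (2 * p) + 2 * (2 * (p + k)) + 4 * (k * k))
                        ≡ 2 * (D + 2 * (p + k)) + (2 * (2 * p) + 4 * (k * k))
      regroup = solve-∀
      expand : ∀ p k → 2 * ((2 * (p + k)) * (2 * (p + k))) + (2 * (2 * p) + 4 * (k * k))
                     ≡ 4 * ((p + k) * (p + k) + 2 * (p + k) * k) + (4 * (p * p) + 4 * p)
      expand = solve-∀

  edge-bound-arithmetic : 4 * e + Q ≤ 2 * D → e + (k * k + k) ≤ (p + k) * (p + k) + 2 * (p + k) * k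
  edge-bound-arithmetic 4e+Q≤2D = *-cancelˡ-≤ 4 (+-cancelʳ-≤ X _ _ (begin
    4 * (e + (k * k + k)) + X                      ≡⟨ sym lhs-identity ⟩
    4 * e + Q + K                                  ≤⟨ +-monoˡ-≤ K 4e+Q≤2D ⟩
    2 * D + K                                      ≡⟨ rhs-identity ⟩
    4 * ((p + k) * (p + k) + 2 * (p + k) * k) + X  ∎))
    where open ≤-Reasoning

  edge-equality-arithmetic : e + (k * k + k) ≡ (p + k) * (p + k) + 2 * (p + k) * k → 4 * e + Q ≡ 2 * D
  edge-equality-arithmetic e≡ = +-cancelʳ-≡ K _ _
    (trans lhs-identity (trans (cong (λ l → 4 * l + X) e≡) (sym rhs-identity)))

-- Ĥ_{p,0} ∨ K_q with U = [0, p), V = [p, 2p) and the clique K_q on [2p, 2p + q)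
extremalAdj : ℕ → ℕ → ℕ → Bool
extremalAdj p i j =
  if i <ᵇ p then (if j <ᵇ p then false else (if j <ᵇ p + p then (j ∸ p) ≤ᵇ i else true))
  else if i <ᵇ p + p then (if j <ᵇ p then (i ∸ p) ≤ᵇ j else (if j <ᵇ p + p then not (i ≡ᵇ j) else true))
  else (if j <ᵇ p + p then true else not (i ≡ᵇ j))

data Part (p i : ℕ) : Set where
  inU : i < p → Part p i
  inV : p ≤ i → i < p + p → Part p i
  inK : p + p ≤ i → Part p i

part : ∀ p i → Part p i
part p i with i <? p | i <? p + p
... | yes i<p | _         = inU i<p
... | no i≮p  | yes i<2p  = inV (≮⇒≥ i≮p) i<2p
... | no _    | no i≮2p   = inK (≮⇒≥ i≮2p)

module _ {p : ℕ} where

  private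
    p≤2p : p ≤ p + p
    p≤2p = m≤m+n p p

  extremalAdj-sym : ∀ i j → extremalAdj p i j ≡ extremalAdj p j i
  extremalAdj-sym i j with part p i | part p j
  ... | inU i<p | inU j<p rewrite <ᵇ-true i<p | <ᵇ-true j<p = refl
  ... | inU i<p | inV p≤j j<2p rewrite <ᵇ-true i<p | <ᵇ-false p≤j | <ᵇ-true j<2p = refl
  ... | inU i<p | inK 2p≤j
    rewrite <ᵇ-true i<p | <ᵇ-true (<-≤-trans i<p p≤2p) | <ᵇ-false (≤-trans p≤2p 2p≤j) | <ᵇ-false 2p≤j = refl
  ... | inV p≤i i<2p | inU j<p rewrite <ᵇ-true j<p | <ᵇ-false p≤i | <ᵇ-true i<2p = refl
  ... | inV p≤i i<2p | inV p≤j j<2p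
    rewrite <ᵇ-false p≤i | <ᵇ-true i<2p | <ᵇ-false p≤j | <ᵇ-true j<2p | ≡ᵇ-sym i j = refl
  ... | inV p≤i i<2p | inK 2p≤j
    rewrite <ᵇ-false p≤i | <ᵇ-true i<2p | <ᵇ-false (≤-trans p≤2p 2p≤j) | <ᵇ-false 2p≤j = refl
  ... | inK 2p≤i | inU j<p
    rewrite <ᵇ-true j<p | <ᵇ-true (<-≤-trans j<p p≤2p) | <ᵇ-false (≤-trans p≤2p 2p≤i) | <ᵇ-false 2p≤i = refl
  ... | inK 2p≤i | inV p≤j j<2p
    rewrite <ᵇ-false p≤j | <ᵇ-true j<2p | <ᵇ-false (≤-trans p≤2p 2p≤i) | <ᵇ-false 2p≤i = refl
  ... | inK 2p≤i | inK 2p≤j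
    rewrite <ᵇ-false (≤-trans p≤2p 2p≤i) | <ᵇ-false 2p≤i | <ᵇ-false (≤-trans p≤2p 2p≤j) | <ᵇ-false 2p≤j | ≡ᵇ-sym i j = refl

  extremalAdj-UU : ∀ {i j} → i < p → j < p → extremalAdj p i j ≡ false
  extremalAdj-UU i<p j<p rewrite <ᵇ-true i<p | <ᵇ-true j<p = refl

  extremalAdj-UV : ∀ {i j} → i < p → j < p → extremalAdj p i (p + j) ≡ (j ≤ᵇ i)
  extremalAdj-UV {i} {j} i<p j<p
    rewrite <ᵇ-true i<p | <ᵇ-false (m≤m+n p j) | <ᵇ-true (+-monoʳ-< p j<p) | m+n∸m≡n p j = refl

  extremalAdj-VU : ∀ {i j} → i < p → j < p → extremalAdj p (p + i) j ≡ (i ≤ᵇ j)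
  extremalAdj-VU {i} {j} i<p j<p = trans (extremalAdj-sym (p + i) j) (extremalAdj-UV j<p i<p)

  extremalAdj-VV : ∀ {i j} → i < p → j < p → extremalAdj p (p + i) (p + j) ≡ not (i ≡ᵇ j)
  extremalAdj-VV {i} {j} i<p j<p
    rewrite <ᵇ-false (m≤m+n p i) | <ᵇ-true (+-monoʳ-< p i<p) | <ᵇ-false (m≤m+n p j) | <ᵇ-true (+-monoʳ-< p j<p)
          | ≡ᵇ-+ p i j = refl

  extremalAdj-KH : ∀ {i j} → p + p ≤ i → j < p + p → extremalAdj p i j ≡ true
  extremalAdj-KH {i} {j} 2p≤i j<2p with part p j
  ... | inU _   rewrite <ᵇ-false (≤-trans p≤2p 2p≤i) | <ᵇ-false 2p≤i | <ᵇ-true j<2p = refl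
  ... | inV _ _ rewrite <ᵇ-false (≤-trans p≤2p 2p≤i) | <ᵇ-false 2p≤i | <ᵇ-true j<2p = refl
  ... | inK 2p≤j = ⊥-elim (<-irrefl refl (<-≤-trans j<2p 2p≤j))

  extremalAdj-HK : ∀ {i j} → i < p + p → p + p ≤ j → extremalAdj p i j ≡ true
  extremalAdj-HK {i} {j} i<2p 2p≤j = trans (extremalAdj-sym i j) (extremalAdj-KH 2p≤j i<2p)

  extremalAdj-KK : ∀ {i j} → p + p ≤ i → p + p ≤ j → extremalAdj p i j ≡ not (i ≡ᵇ j)
  extremalAdj-KK 2p≤i 2p≤j rewrite <ᵇ-false (≤-trans p≤2p 2p≤i) | <ᵇ-false 2p≤i | <ᵇ-false 2p≤j = refl


split-view : ∀ a b (X : Fin (a + b)) → (∃ λ i → X ≡ i ↑ˡ b) ⊎ (∃ λ j → X ≡ a ↑ʳ j)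
split-view a b X with splitAt a X in eq
... | inj₁ i = inj₁ (i , trans (sym (join-splitAt a b X)) (cong (join a b) eq))
... | inj₂ j = inj₂ (j , trans (sym (join-splitAt a b X)) (cong (join a b) eq))

⌊≟⌋≡≡ᵇ : ∀ {q} (i j : Fin q) → ⌊ i ≟ j ⌋ ≡ (toℕ i ≡ᵇ toℕ j)
⌊≟⌋≡≡ᵇ i j with i ≟ j
... | yes refl = sym (≡ᵇ-refl (toℕ i))
... | no i≢j   = sym (≡ᵇ-false (λ eq → i≢j (toℕ-injective eq)))

hatH-adj≡extremalAdj : ∀ p (X Y : Fin (p + p)) → hatH-adj p X Y ≡ extremalAdj p (toℕ X) (toℕ Y)
hatH-adj≡extremalAdj p X Y with split-view p p X | split-view p p Y
... | inj₁ (i , refl) | inj₁ (j , refl)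
  rewrite splitAt-↑ˡ p i p | splitAt-↑ˡ p j p | toℕ-↑ˡ i p | toℕ-↑ˡ j p = sym (extremalAdj-UU (toℕ<n i) (toℕ<n j))
... | inj₁ (i , refl) | inj₂ (j , refl)
  rewrite splitAt-↑ˡ p i p | splitAt-↑ʳ p p j | toℕ-↑ˡ i p | toℕ-↑ʳ p j = sym (extremalAdj-UV (toℕ<n i) (toℕ<n j))
... | inj₂ (i , refl) | inj₁ (j , refl)
  rewrite splitAt-↑ʳ p p i | splitAt-↑ˡ p j p | toℕ-↑ʳ p i | toℕ-↑ˡ j p = sym (extremalAdj-VU (toℕ<n i) (toℕ<n j))
... | inj₂ (i , refl) | inj₂ (j , refl)
  rewrite splitAt-↑ʳ p p i | splitAt-↑ʳ p p j | toℕ-↑ʳ p i | toℕ-↑ʳ p j =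
    trans (cong not (⌊≟⌋≡≡ᵇ i j)) (sym (extremalAdj-VV (toℕ<n i) (toℕ<n j)))

join-adj≡extremalAdj : ∀ p q (X Y : Fin (p + p + q)) →
                       join-adj (hatH p) (complete q) X Y ≡ extremalAdj p (toℕ X) (toℕ Y)
join-adj≡extremalAdj p q X Y with split-view (p + p) q X | split-view (p + p) q Y
... | inj₁ (i , refl) | inj₁ (j , refl)
  rewrite splitAt-↑ˡ (p + p) i q | splitAt-↑ˡ (p + p) j q | toℕ-↑ˡ i q | toℕ-↑ˡ j q = hatH-adj≡extremalAdj p i j
... | inj₁ (i , refl) | inj₂ (j , refl)
  rewrite splitAt-↑ˡ (p + p) i q | splitAt-↑ʳ (p + p) q j | toℕ-↑ˡ i q | toℕ-↑ʳ (p + p) j =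
    sym (extremalAdj-HK {p} (toℕ<n i) (m≤m+n (p + p) (toℕ j)))
... | inj₂ (i , refl) | inj₁ (j , refl)
  rewrite splitAt-↑ʳ (p + p) q i | splitAt-↑ˡ (p + p) j q | toℕ-↑ʳ (p + p) i | toℕ-↑ˡ j q =
    sym (extremalAdj-KH {p} (m≤m+n (p + p) (toℕ i)) (toℕ<n j))
... | inj₂ (i , refl) | inj₂ (j , refl)
  rewrite splitAt-↑ʳ (p + p) q i | splitAt-↑ʳ (p + p) q j | toℕ-↑ʳ (p + p) i | toℕ-↑ʳ (p + p) j =
    trans (cong not (trans (⌊≟⌋≡≡ᵇ i j) (sym (≡ᵇ-+ (p + p) (toℕ i) (toℕ j)))))
      (sym (extremalAdj-KK {p} (m≤m+n (p + p) (toℕ i)) (m≤m+n (p + p) (toℕ j))))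

∑∑-const : ∀ a b c → ∑[ i < a ] ∑[ j < b ] c ≡ a * (b * c)
∑∑-const a b c = trans (sum-cong-≗ {a} (λ _ → ∑-const b c)) (∑-const a (b * c))

∑∑-splitAt : ∀ a b (F : Fin (a + b) → Fin (a + b) → ℕ) →
  ∑[ x < a + b ] ∑[ y < a + b ] F x y ≡
  (∑[ i < a ] ∑[ j < a ] F (i ↑ˡ b) (j ↑ˡ b) + ∑[ i < a ] ∑[ j < b ] F (i ↑ˡ b) (a ↑ʳ j)) +
  (∑[ i < b ] ∑[ j < a ] F (a ↑ʳ i) (j ↑ˡ b) + ∑[ i < b ] ∑[ j < b ] F (a ↑ʳ i) (a ↑ʳ j))
∑∑-splitAt a b F =
  trans (sum-cong-≗ {a + b} (λ x → ∑-splitAt a b (F x)))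
   (trans (∑-splitAt a b _)
    (cong₂ _+_ (∑-distrib-+ (λ i → ∑[ j < a ] F (i ↑ˡ b) (j ↑ˡ b)) (λ i → ∑[ j < b ] F (i ↑ˡ b) (a ↑ʳ j)))
               (∑-distrib-+ (λ i → ∑[ j < a ] F (a ↑ʳ i) (j ↑ˡ b)) (λ i → ∑[ j < b ] F (a ↑ʳ i) (a ↑ʳ j)))))

orderedPairs-join : ∀ {a b} (G : Graph a) (H : Graph b) →
  orderedPairs (join-adj G H) ≡ (orderedPairs (adj G) + a * (b * 1)) + (b * (a * 1) + orderedPairs (adj H))
orderedPairs-join {a} {b} G H = trans (∑∑-splitAt a b _)
  (cong₂ _+_ (cong₂ _+_ (∑∑χ-cong GG) (trans (∑∑χ-cong GH) (∑∑-const a b 1)))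
             (cong₂ _+_ (trans (∑∑χ-cong HG) (∑∑-const b a 1)) (∑∑χ-cong HH)))
  where
  GG : ∀ i j → join-adj G H (i ↑ˡ b) (j ↑ˡ b) ≡ adj G i j
  GG i j rewrite splitAt-↑ˡ a i b | splitAt-↑ˡ a j b = refl
  GH : ∀ i j → join-adj G H (i ↑ˡ b) (a ↑ʳ j) ≡ true
  GH i j rewrite splitAt-↑ˡ a i b | splitAt-↑ʳ a b j = refl
  HG : ∀ i j → join-adj G H (a ↑ʳ i) (j ↑ˡ b) ≡ true
  HG i j rewrite splitAt-↑ʳ a b i | splitAt-↑ˡ a j b = refl
  HH : ∀ i j → join-adj G H (a ↑ʳ i) (a ↑ʳ j) ≡ adj H i j
  HH i j rewrite splitAt-↑ʳ a b i | splitAt-↑ʳ a b j = refl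

orderedPairs-complete : ∀ q → orderedPairs (neq {q}) + q ≡ q * q
orderedPairs-complete q = begin
  orderedPairs (neq {q}) + q                      ≡⟨ cong (orderedPairs (neq {q}) +_) (sym (trans (∑-const q 1) (*-identityʳ q))) ⟩
  orderedPairs (neq {q}) + ∑[ i < q ] 1           ≡⟨ sym (∑-distrib-+ (λ i → ∑[ j < q ] χ (neq i j)) (λ _ → 1)) ⟩
  ∑[ i < q ] (∑[ j < q ] χ (neq i j) + 1)         ≡⟨ sum-cong-≗ {q} (λ i → trans (cong (_+ 1) (sum-cong-≗ (neq-as-does i))) (∑-χ-≢ i)) ⟩
  ∑[ i < q ] q                                    ≡⟨ ∑-const q q ⟩
  q * q                                           ∎
  where
  open ≡-Reasoning
  neq-as-does : ∀ (i j : Fin q) → χ (neq i j) ≡ χ (not (does (j ≟ i)))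
  neq-as-does i j = cong χ (trans (neq-sym i j) (cong not (isYes≗does (j ≟ i))))

∑∑-comparisons : ∀ p → ∑[ i < p ] ∑[ j < p ] (χ (toℕ j ≤ᵇ toℕ i) + χ (toℕ i ≤ᵇ toℕ j)) ≡ p * p + p
∑∑-comparisons p = begin
  ∑[ i < p ] ∑[ j < p ] (χ (toℕ j ≤ᵇ toℕ i) + χ (toℕ i ≤ᵇ toℕ j))
    ≡⟨ sum-cong-≗ {p} (λ i → trans (sum-cong-≗ (comparisons i)) (∑-distrib-+ {p} (λ _ → 1) (λ j → χ (does (j ≟ i))))) ⟩
  ∑[ i < p ] (∑[ j < p ] 1 + ∑[ j < p ] χ (does (j ≟ i)))
    ≡⟨ sum-cong-≗ {p} (λ i → cong₂ _+_ (trans (∑-const p 1) (*-identityʳ p)) (∑-χ-≡ i)) ⟩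
  ∑[ i < p ] (p + 1)
    ≡⟨ ∑-const p (p + 1) ⟩
  p * (p + 1)
    ≡⟨ trans (*-distribˡ-+ p p 1) (cong (p * p +_) (*-identityʳ p)) ⟩
  p * p + p ∎
  where
  open ≡-Reasoning
  comparisons : ∀ (i j : Fin p) → χ (toℕ j ≤ᵇ toℕ i) + χ (toℕ i ≤ᵇ toℕ j) ≡ 1 + χ (does (j ≟ i))
  comparisons i j with <-cmp (toℕ i) (toℕ j)
  ... | tri< i<j _ _ rewrite ≤ᵇ-false i<j | ≤ᵇ-true (<⇒≤ i<j) | dec-false (j ≟ i) (λ eq → <⇒≢ i<j (cong toℕ (sym eq))) = refl
  ... | tri≈ _ i≡j _ rewrite toℕ-injective i≡j | ≤ᵇ-true (≤-refl {toℕ j}) | dec-true (j ≟ j) refl = refl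
  ... | tri> _ _ i>j rewrite ≤ᵇ-false i>j | ≤ᵇ-true (<⇒≤ i>j) | dec-false (j ≟ i) (λ eq → <⇒≢ i>j (cong toℕ eq)) = refl

module _ (p : ℕ) where

  hatH-UU : ∀ i j → hatH-adj p (i ↑ˡ p) (j ↑ˡ p) ≡ false
  hatH-UU i j rewrite splitAt-↑ˡ p i p | splitAt-↑ˡ p j p = refl

  hatH-UV : ∀ i j → hatH-adj p (i ↑ˡ p) (p ↑ʳ j) ≡ (toℕ j ≤ᵇ toℕ i)
  hatH-UV i j rewrite splitAt-↑ˡ p i p | splitAt-↑ʳ p p j = refl

  hatH-VU : ∀ i j → hatH-adj p (p ↑ʳ i) (j ↑ˡ p) ≡ (toℕ i ≤ᵇ toℕ j)
  hatH-VU i j rewrite splitAt-↑ʳ p p i | splitAt-↑ˡ p j p = refl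

  hatH-VV : ∀ i j → hatH-adj p (p ↑ʳ i) (p ↑ʳ j) ≡ neq i j
  hatH-VV i j rewrite splitAt-↑ʳ p p i | splitAt-↑ʳ p p j = refl

orderedPairs-hatH : ∀ p → orderedPairs (hatH-adj p) + p ≡ p * p + p + p * p
orderedPairs-hatH p = begin
  orderedPairs (hatH-adj p) + p
    ≡⟨ cong (_+ p) (∑∑-splitAt p p _) ⟩
  ((UU + UV) + (VU + VV)) + p
    ≡⟨ cong (λ z → ((z + UV) + (VU + VV)) + p) UU≡0 ⟩
  ((0 + UV) + (VU + VV)) + p
    ≡⟨ regroup UV VU VV p ⟩
  (UV + VU) + (VV + p)
    ≡⟨ cong₂ _+_ UV+VU (trans (cong (_+ p) (∑∑χ-cong (hatH-VV p))) (orderedPairs-complete p)) ⟩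
  p * p + p + p * p ∎
  where
  open ≡-Reasoning
  UU = ∑[ i < p ] ∑[ j < p ] χ (hatH-adj p (i ↑ˡ p) (j ↑ˡ p))
  UV = ∑[ i < p ] ∑[ j < p ] χ (hatH-adj p (i ↑ˡ p) (p ↑ʳ j))
  VU = ∑[ i < p ] ∑[ j < p ] χ (hatH-adj p (p ↑ʳ i) (j ↑ˡ p))
  VV = ∑[ i < p ] ∑[ j < p ] χ (hatH-adj p (p ↑ʳ i) (p ↑ʳ j))
  UU≡0 : UU ≡ 0
  UU≡0 = trans (∑∑χ-cong (hatH-UU p))
               (trans (∑∑-const p p 0) (trans (cong (p *_) (*-zeroʳ p)) (*-zeroʳ p)))
  regroup : ∀ a b c d → ((0 + a) + (b + c)) + d ≡ (a + b) + (c + d)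
  regroup = solve-∀
  UV+VU : UV + VU ≡ p * p + p
  UV+VU = begin
    UV + VU
      ≡⟨ cong₂ _+_ (∑∑χ-cong (hatH-UV p)) (∑∑χ-cong (hatH-VU p)) ⟩
    ∑[ i < p ] ∑[ j < p ] χ (toℕ j ≤ᵇ toℕ i) + ∑[ i < p ] ∑[ j < p ] χ (toℕ i ≤ᵇ toℕ j)
      ≡⟨ sym (∑∑-distrib-+ {p} {p} (λ i j → χ (toℕ j ≤ᵇ toℕ i)) (λ i j → χ (toℕ i ≤ᵇ toℕ j))) ⟩
    ∑[ i < p ] ∑[ j < p ] (χ (toℕ j ≤ᵇ toℕ i) + χ (toℕ i ≤ᵇ toℕ j))
      ≡⟨ ∑∑-comparisons p ⟩
    p * p + p ∎

e-extremal : ∀ p k → e (hatH p ∨ᵍ complete (2 * k)) + (k * k + k) ≡ (p + k) * (p + k) + 2 * (p + k) * k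
e-extremal p k = *-cancelˡ-≡ _ _ 2 (+-cancelʳ-≡ (p + 2 * k) _ _ (begin
  2 * (e X + (k * k + k)) + (p + 2 * k)
    ≡⟨ regroup (e X) p k ⟩
  2 * e X + (p + 2 * k + 2 * (k * k + k))
    ≡⟨ cong (_+ (p + 2 * k + 2 * (k * k + k))) (trans (sym (orderedPairs-adj X)) (orderedPairs-join (hatH p) (complete (2 * k)))) ⟩
  (H + (p + p) * (2 * k * 1)) + (2 * k * ((p + p) * 1) + K) + (p + 2 * k + 2 * (k * k + k))
    ≡⟨ regroup′ H K p k ⟩
  (H + p) + (K + 2 * k) + ((p + p) * (2 * k * 1) + 2 * k * ((p + p) * 1) + 2 * (k * k + k))
    ≡⟨ cong₂ (λ u v → u + v + ((p + p) * (2 * k * 1) + 2 * k * ((p + p) * 1) + 2 * (k * k + k)))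
             (orderedPairs-hatH p) (orderedPairs-complete (2 * k)) ⟩
  (p * p + p + p * p) + 2 * k * (2 * k) + ((p + p) * (2 * k * 1) + 2 * k * ((p + p) * 1) + 2 * (k * k + k))
    ≡⟨ expand p k ⟩
  2 * ((p + k) * (p + k) + 2 * (p + k) * k) + (p + 2 * k) ∎))
  where
  open ≡-Reasoning
  X = hatH p ∨ᵍ complete (2 * k)
  H = orderedPairs (hatH-adj p)
  K = orderedPairs (neq {2 * k})
  regroup : ∀ e p k → 2 * (e + (k * k + k)) + (p + 2 * k) ≡ 2 * e + (p + 2 * k + 2 * (k * k + k))
  regroup = solve-∀
  regroup′ : ∀ H K p k → (H + (p + p) * (2 * k * 1)) + (2 * k * ((p + p) * 1) + K) + (p + 2 * k + 2 * (k * k + k))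
           ≡ (H + p) + (K + 2 * k) + ((p + p) * (2 * k * 1) + 2 * k * ((p + p) * 1) + 2 * (k * k + k))
  regroup′ = solve-∀
  expand : ∀ p k → (p * p + p + p * p) + 2 * k * (2 * k) + ((p + p) * (2 * k * 1) + 2 * k * ((p + p) * 1) + 2 * (k * k + k))
         ≡ 2 * ((p + k) * (p + k) + 2 * (p + k) * k) + (p + 2 * k)
  expand = solve-∀

injective⇒surjective : ∀ {a b} → a ≡ b → (f : Fin a → Fin b) → (∀ {x y} → f x ≡ f y → x ≡ y) →
                       ∀ y → ∃ λ x → f x ≡ y
injective⇒surjective {suc a} refl f f-injective y with any? (λ x → f x ≟ y)
... | yes hit = hit
... | no miss with pigeonhole (n<1+n a) (λ x → punchOut {i = y} {j = f x} (λ eq → miss (x , sym eq)))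
...   | i , j , i<j , same =
  ⊥-elim (<-irrefl (cong toℕ (f-injective (punchOut-injective {i = y} (λ eq → miss (i , sym eq)) (λ eq → miss (j , sym eq)) same))) i<j)

module ForcingSet {m} (G : Graph m) (M : PerfectMatching G) (S : EdgeSet m) (forcing : IsForcingSet S M) where

  μ : Fin m → Fin m
  μ = mate M

  A : Fin m → Fin m → Bool
  A = adj G

  μ-involutive : ∀ x → μ (μ x) ≡ x
  μ-involutive = mate-inv M

  μ-adj : ∀ x → A x (μ x) ≡ true
  μ-adj = mate-adj M

  μ-injective : ∀ {x y} → μ x ≡ μ y → x ≡ y
  μ-injective {x} {y} μx≡μy = trans (sym (μ-involutive x)) (trans (cong μ μx≡μy) (μ-involutive y))

  μx≢x : ∀ x → μ x ≢ x
  μx≢x x μx≡x with trans (sym (adj-irrefl G x)) (trans (cong (A x) (sym μx≡x)) (μ-adj x))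
  ... | ()

  x≢μx : ∀ x → x ≢ μ x
  x≢μx x = ≢-sym (μx≢x x)

  μ-≢ : ∀ {x y} → x ≢ y → μ x ≢ μ y
  μ-≢ x≢y μx≡μy = x≢y (μ-injective μx≡μy)

  ≢μ⇒μ≢ : ∀ {x y} → x ≢ μ y → μ x ≢ y
  ≢μ⇒μ≢ {x} x≢μy μx≡y = x≢μy (trans (sym (μ-involutive x)) (cong μ μx≡y))

  μ≢⇒≢μ : ∀ {x y} → μ x ≢ y → x ≢ μ y
  μ≢⇒≢μ {x} {y} μx≢y x≡μy = μx≢y (trans (cong μ x≡μy) (μ-involutive y))

  covered : Fin m → Bool
  covered x = S x (μ x)

  covered-μ : ∀ x → covered (μ x) ≡ covered x
  covered-μ x = trans (cong (S (μ x)) (μ-involutive x)) (proj₁ (proj₁ forcing) (μ x) x)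

  S⇒covered : ∀ i j → S i j ≡ true → covered i ≡ true
  S⇒covered i j Sij = trans (cong (S i) (proj₂ (proj₁ forcing) i j Sij)) Sij

  covered≢uncovered : ∀ {v w} → covered v ≡ true → covered w ≡ false → v ≢ w
  covered≢uncovered cv cw refl with trans (sym cv) cw
  ... | ()

  rigid : (μ' : Fin m → Fin m) → (∀ v → μ' (μ' v) ≡ v) → (∀ v → A v (μ' v) ≡ true) →
          (∀ v → covered v ≡ true → μ' v ≡ μ v) → ∀ v → μ' v ≡ μ v
  rigid μ' μ'-inv μ'-adj agree =
    proj₂ forcing M' (proj₁ (proj₁ forcing) , λ i j Sij → trans (agree i (S⇒covered i j Sij)) (proj₂ (proj₁ forcing) i j Sij))
    where
    M' : PerfectMatching G
    M' = record { mate = μ' ; mate-inv = μ'-inv ; mate-adj = μ'-adj }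

  free : Fin m → Fin m → Bool
  free x a = not (covered x) ∧ not (covered a) ∧ not (does (a ≟ x)) ∧ not (does (a ≟ μ x))

  Free : Fin m → Fin m → Set
  Free x a = free x a ≡ true

  free⇒ : ∀ {x a} → Free x a → covered x ≡ false × covered a ≡ false × a ≢ x × a ≢ μ x
  free⇒ {x} {a} free-xa with nots-true⇒falses _ _ _ _ free-xa
  ... | cx , ca , a≟x , a≟μx = cx , ca , does-false⇒¬ (a ≟ x) a≟x , does-false⇒¬ (a ≟ μ x) a≟μx

  ⇒free : ∀ {x a} → covered x ≡ false → covered a ≡ false → a ≢ x → a ≢ μ x → Free x a
  ⇒free {x} {a} cx ca a≢x a≢μx rewrite cx | ca | dec-false (a ≟ x) a≢x | dec-false (a ≟ μ x) a≢μx = refl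


  module _ {x a} (free-xa : Free x a) where

    free-uncoveredˡ : covered x ≡ false
    free-uncoveredˡ = proj₁ (free⇒ free-xa)

    free-uncoveredʳ : covered a ≡ false
    free-uncoveredʳ = proj₁ (proj₂ (free⇒ free-xa))

    free-≢ : a ≢ x
    free-≢ = proj₁ (proj₂ (proj₂ (free⇒ free-xa)))

    free-≢μ : a ≢ μ x
    free-≢μ = proj₂ (proj₂ (proj₂ (free⇒ free-xa)))

    free-sym : Free a x
    free-sym = ⇒free free-uncoveredʳ free-uncoveredˡ (≢-sym free-≢) (μ≢⇒≢μ (≢-sym free-≢μ))

    free-μʳ : Free x (μ a)
    free-μʳ = ⇒free free-uncoveredˡ (trans (covered-μ a) free-uncoveredʳ) (≢μ⇒μ≢ free-≢μ) (μ-≢ free-≢)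

  free-μˡ : ∀ {x a} → Free x a → Free (μ x) a
  free-μˡ free-xa = free-sym (free-μʳ (free-sym free-xa))

  free-irrefl : ∀ x → free x x ≡ false
  free-irrefl x with free x x in free-xx
  ... | true  = ⊥-elim (free-≢ free-xx refl)
  ... | false = refl

  free-mate : ∀ x → free x (μ x) ≡ false
  free-mate x with free x (μ x) in free-xμx
  ... | true  = ⊥-elim (free-≢μ free-xμx refl)
  ... | false = refl

  -- Switching M along the alternating cycle x a μa μx gives a second perfect matching containing S.
  no-alternating-4-cycle : ∀ {x a} → Free x a → A x a ≡ true → A (μ x) (μ a) ≡ true → ⊥
  no-alternating-4-cycle {x} {a} free-xa Axa Aμxμa = a≢μx (trans (sym μ'x≡a) (μ'≗μ x))
    where
    a≢x = free-≢ free-xa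
    a≢μx = free-≢μ free-xa
    μa≢μx : μ a ≢ μ x
    μa≢μx = μ-≢ a≢x
    t = transpose (μ x) a
    μ' = conjugate (μ x) a μ
    x-fixed : t x ≡ x
    x-fixed = transpose-other (μ x) a (x≢μx x) (≢-sym a≢x)
    μa-fixed : t (μ a) ≡ μ a
    μa-fixed = transpose-other (μ x) a μa≢μx (μx≢x a)
    μ'x≡a : μ' x ≡ a
    μ'x≡a = trans (cong (λ v → t (μ v)) x-fixed) (transpose-i (μ x) a)
    μ'a≡x : μ' a ≡ x
    μ'a≡x = trans (cong (λ v → t (μ v)) (transpose-j (μ x) a)) (trans (cong t (μ-involutive x)) x-fixed)
    μ'μx≡μa : μ' (μ x) ≡ μ a
    μ'μx≡μa = trans (cong (λ v → t (μ v)) (transpose-i (μ x) a)) μa-fixed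
    μ'μa≡μx : μ' (μ a) ≡ μ x
    μ'μa≡μx = trans (cong (λ v → t (μ v)) μa-fixed) (trans (cong t (μ-involutive a)) (transpose-j (μ x) a))
    elsewhere : ∀ {v} → v ≢ x → v ≢ a → v ≢ μ x → v ≢ μ a → μ' v ≡ μ v
    elsewhere v≢x v≢a v≢μx v≢μa = conjugate-other (μ x) a μ v≢μx v≢a (μ-≢ v≢x) (≢μ⇒μ≢ v≢μa)
    μ'-adj : ∀ v → A v (μ' v) ≡ true
    μ'-adj v = by-cases (v ≟ x) (v ≟ a) (v ≟ μ x) (v ≟ μ a)
      where
      by-cases : Dec (v ≡ x) → Dec (v ≡ a) → Dec (v ≡ μ x) → Dec (v ≡ μ a) → A v (μ' v) ≡ true
      by-cases (yes refl) _ _ _                = trans (cong (A v) μ'x≡a) Axa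
      by-cases (no _) (yes refl) _ _           = trans (cong (A v) μ'a≡x) (trans (adj-sym G a x) Axa)
      by-cases (no _) (no _) (yes refl) _      = trans (cong (A v) μ'μx≡μa) Aμxμa
      by-cases (no _) (no _) (no _) (yes refl) = trans (cong (A v) μ'μa≡μx) (trans (adj-sym G (μ a) (μ x)) Aμxμa)
      by-cases (no v≢x) (no v≢a) (no v≢μx) (no v≢μa) = trans (cong (A v) (elsewhere v≢x v≢a v≢μx v≢μa)) (μ-adj v)
    μ'≗μ : ∀ v → μ' v ≡ μ v
    μ'≗μ = rigid μ' (conjugate-involutive (μ x) a μ μ-involutive) μ'-adj λ v cv →
      elsewhere (covered≢uncovered cv (free-uncoveredˡ free-xa)) (covered≢uncovered cv (free-uncoveredʳ free-xa))
                (covered≢uncovered cv (trans (covered-μ x) (free-uncoveredˡ free-xa)))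
                (covered≢uncovered cv (trans (covered-μ a) (free-uncoveredʳ free-xa)))

  private
    module SixCycle {a b c} (free-ab : Free a b) (free-bc : Free b c) (free-ca : Free c a) where

      b≢a = free-≢ free-ab
      c≢b = free-≢ free-bc
      a≢c = free-≢ free-ca
      a≢μc = free-≢μ free-ca
      μa≢b = ≢-sym (free-≢μ free-ab)
      μb≢c = ≢-sym (free-≢μ free-bc)
      μc≢a = ≢-sym a≢μc
      a≢μb = μ≢⇒≢μ μa≢b
      b≢μc = μ≢⇒≢μ μb≢c
      c≢μa = μ≢⇒≢μ μc≢a
      μb≢μa = μ-≢ b≢a
      μc≢μb = μ-≢ c≢b
      μa≢μc = μ-≢ a≢c
      μc≢μa = ≢-sym μa≢μc
      μb≢μc = ≢-sym μc≢μb

      -- μ₂ is μ conjugated by the 3-cycle (μa μb μc): it matches a μb, b μc, c μa.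
      t₁ = transpose (μ a) (μ b)
      t₂ = transpose (μ a) (μ c)
      μ₁ = conjugate (μ a) (μ b) μ
      μ₂ = conjugate (μ a) (μ c) μ₁

      μ₂-involutive : ∀ v → μ₂ (μ₂ v) ≡ v
      μ₂-involutive = conjugate-involutive (μ a) (μ c) μ₁ (conjugate-involutive (μ a) (μ b) μ μ-involutive)

      t₁-other : ∀ {v} → v ≢ μ a → v ≢ μ b → t₁ v ≡ v
      t₁-other = transpose-other (μ a) (μ b)
      t₂-other : ∀ {v} → v ≢ μ a → v ≢ μ c → t₂ v ≡ v
      t₂-other = transpose-other (μ a) (μ c)

      μ₂a : μ₂ a ≡ μ b
      μ₂a = trans (cong (λ v → t₂ (μ₁ v)) (t₂-other (x≢μx a) a≢μc))
            (trans (cong (λ v → t₂ (t₁ (μ v))) (t₁-other (x≢μx a) a≢μb))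
            (trans (cong t₂ (transpose-i (μ a) (μ b))) (t₂-other μb≢μa μb≢μc)))
      μ₂b : μ₂ b ≡ μ c
      μ₂b = trans (cong (λ v → t₂ (μ₁ v)) (t₂-other (≢-sym μa≢b) b≢μc))
            (trans (cong (λ v → t₂ (t₁ (μ v))) (t₁-other (≢-sym μa≢b) (x≢μx b)))
            (trans (cong t₂ (transpose-j (μ a) (μ b))) (transpose-i (μ a) (μ c))))
      μ₂c : μ₂ c ≡ μ a
      μ₂c = trans (cong (λ v → t₂ (μ₁ v)) (t₂-other c≢μa (x≢μx c)))
            (trans (cong (λ v → t₂ (t₁ (μ v))) (t₁-other c≢μa (≢-sym μb≢c)))
            (trans (cong t₂ (t₁-other μc≢μa μc≢μb)) (transpose-j (μ a) (μ c))))
      μ₂μa : μ₂ (μ a) ≡ c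
      μ₂μa = trans (cong (λ v → t₂ (μ₁ v)) (transpose-i (μ a) (μ c)))
             (trans (cong (λ v → t₂ (t₁ (μ v))) (t₁-other μc≢μa μc≢μb))
             (trans (cong (λ v → t₂ (t₁ v)) (μ-involutive c))
             (trans (cong t₂ (t₁-other c≢μa (≢-sym μb≢c))) (t₂-other c≢μa (x≢μx c)))))
      μ₂μb : μ₂ (μ b) ≡ a
      μ₂μb = trans (cong (λ v → t₂ (μ₁ v)) (t₂-other μb≢μa μb≢μc))
             (trans (cong (λ v → t₂ (t₁ (μ v))) (transpose-j (μ a) (μ b)))
             (trans (cong (λ v → t₂ (t₁ v)) (μ-involutive a))
             (trans (cong t₂ (t₁-other (x≢μx a) a≢μb)) (t₂-other (x≢μx a) a≢μc))))
      μ₂μc : μ₂ (μ c) ≡ b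
      μ₂μc = trans (cong (λ v → t₂ (μ₁ v)) (transpose-j (μ a) (μ c)))
             (trans (cong (λ v → t₂ (t₁ (μ v))) (transpose-i (μ a) (μ b)))
             (trans (cong (λ v → t₂ (t₁ v)) (μ-involutive b))
             (trans (cong t₂ (t₁-other (≢-sym μa≢b) (x≢μx b))) (t₂-other (≢-sym μa≢b) b≢μc))))

      μ₂-elsewhere : ∀ {v} → v ≢ a → v ≢ b → v ≢ c → v ≢ μ a → v ≢ μ b → v ≢ μ c → μ₂ v ≡ μ v
      μ₂-elsewhere v≢a v≢b v≢c v≢μa v≢μb v≢μc =
        trans (conjugate-other (μ a) (μ c) μ₁ v≢μa v≢μc (λ eq → μ-≢ v≢a (trans (sym μ₁v) eq))
                                                        (λ eq → μ-≢ v≢c (trans (sym μ₁v) eq)))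
              μ₁v
        where
        μ₁v = conjugate-other (μ a) (μ b) μ v≢μa v≢μb (μ-≢ v≢a) (μ-≢ v≢b)

  -- Rotating M along the alternating cycle a μb b μc c μa gives a second perfect matching containing S.
  no-alternating-6-cycle : ∀ {a b c} → Free a b → Free b c → Free c a →
                           A a (μ b) ≡ true → A b (μ c) ≡ true → A c (μ a) ≡ true → ⊥
  no-alternating-6-cycle {a} {b} {c} free-ab free-bc free-ca Aaμb Abμc Acμa =
    b≢a (μ-injective (trans (sym μ₂a) (μ₂≗μ a)))
    where
    open SixCycle free-ab free-bc free-ca
    uncovered : ∀ {v} → covered v ≡ false → ∀ {w} → covered w ≡ true → w ≢ v
    uncovered cv cw = covered≢uncovered cw cv
    ca = free-uncoveredˡ free-ab
    cb = free-uncoveredˡ free-bc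
    cc = free-uncoveredˡ free-ca
    μ₂-adj : ∀ v → A v (μ₂ v) ≡ true
    μ₂-adj v = by-cases (v ≟ a) (v ≟ b) (v ≟ c) (v ≟ μ a) (v ≟ μ b) (v ≟ μ c)
      where
      by-cases : Dec (v ≡ a) → Dec (v ≡ b) → Dec (v ≡ c) → Dec (v ≡ μ a) → Dec (v ≡ μ b) → Dec (v ≡ μ c) →
                 A v (μ₂ v) ≡ true
      by-cases (yes refl) _ _ _ _ _ = trans (cong (A v) μ₂a) Aaμb
      by-cases (no _) (yes refl) _ _ _ _ = trans (cong (A v) μ₂b) Abμc
      by-cases (no _) (no _) (yes refl) _ _ _ = trans (cong (A v) μ₂c) Acμa
      by-cases (no _) (no _) (no _) (yes refl) _ _ = trans (cong (A v) μ₂μa) (trans (adj-sym G _ _) Acμa)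
      by-cases (no _) (no _) (no _) (no _) (yes refl) _ = trans (cong (A v) μ₂μb) (trans (adj-sym G _ _) Aaμb)
      by-cases (no _) (no _) (no _) (no _) (no _) (yes refl) = trans (cong (A v) μ₂μc) (trans (adj-sym G _ _) Abμc)
      by-cases (no v≢a) (no v≢b) (no v≢c) (no v≢μa) (no v≢μb) (no v≢μc) =
        trans (cong (A v) (μ₂-elsewhere v≢a v≢b v≢c v≢μa v≢μb v≢μc)) (μ-adj v)
    μ₂≗μ : ∀ v → μ₂ v ≡ μ v
    μ₂≗μ = rigid μ₂ μ₂-involutive μ₂-adj λ v cv →
      μ₂-elsewhere (uncovered ca cv) (uncovered cb cv) (uncovered cc cv)
        (uncovered (trans (covered-μ a) ca) cv) (uncovered (trans (covered-μ b) cb) cv) (uncovered (trans (covered-μ c) cc) cv)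

  pairWeight : Fin m → Fin m → ℕ
  pairWeight x a = χ (A x a) + χ (A (μ x) (μ a))

  capacity : Fin m → Fin m → ℕ
  capacity x a = χ (not (does (a ≟ x))) + χ (not (does (a ≟ x)) ∧ not (free x a))

  pairWeight≤capacity : ∀ x a → pairWeight x a ≤ capacity x a
  pairWeight≤capacity x a = by-cases (a ≟ x) (free x a) refl
    where
    by-cases : (a≟x : Dec (a ≡ x)) (f : Bool) → free x a ≡ f →
               pairWeight x a ≤ χ (not (does a≟x)) + χ (not (does a≟x) ∧ not f)
    by-cases (yes refl) _ _ = ≤-reflexive (cong₂ _+_ (cong χ (adj-irrefl G a)) (cong χ (adj-irrefl G (μ a))))
    by-cases (no _) true free-xa = χ+χ≤1 (A x a) (A (μ x) (μ a)) (no-alternating-4-cycle free-xa)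
    by-cases (no _) false _ = +-mono-≤ (χ≤1 (A x a)) (χ≤1 (A (μ x) (μ a)))

  capacity+free : ∀ x a → capacity x a + χ (free x a) ≡ 2 * χ (not (does (a ≟ x)))
  capacity+free x a = by-cases (a ≟ x) (free x a) refl
    where
    by-cases : (a≟x : Dec (a ≡ x)) (f : Bool) → free x a ≡ f →
               χ (not (does a≟x)) + χ (not (does a≟x) ∧ not f) + χ f ≡ 2 * χ (not (does a≟x))
    by-cases (yes refl) _ refl = cong χ (free-irrefl a)
    by-cases (no _) true  _ = refl
    by-cases (no _) false _ = refl

  μ-permutation : Permutation m m
  μ-permutation = permutation μ μ μ-involutive μ-involutive

  ∑∑pairWeight≡4e : ∑[ x < m ] ∑[ a < m ] pairWeight x a ≡ 4 * e G
  ∑∑pairWeight≡4e = begin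
    ∑[ x < m ] ∑[ a < m ] pairWeight x a
      ≡⟨ ∑∑-distrib-+ (λ x a → χ (A x a)) (λ x a → χ (A (μ x) (μ a))) ⟩
    orderedPairs A + ∑[ x < m ] ∑[ a < m ] χ (A (μ x) (μ a))
      ≡⟨ cong (orderedPairs A +_) (sym (trans (∑-permute (λ x → ∑[ a < m ] χ (A x a)) μ-permutation)
                                     (sum-cong-≗ λ x → ∑-permute (λ a → χ (A (μ x) a)) μ-permutation))) ⟩
    orderedPairs A + orderedPairs A
      ≡⟨ cong (λ n → n + n) (orderedPairs-adj G) ⟩
    2 * e G + 2 * e G
      ≡⟨ double-double (e G) ⟩
    4 * e G ∎
    where
    open ≡-Reasoning
    double-double : ∀ n → 2 * n + 2 * n ≡ 4 * n
    double-double = solve-∀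

  offDiagonal : ℕ
  offDiagonal = ∑[ x < m ] ∑[ a < m ] χ (not (does (a ≟ x)))

  offDiagonal+m : offDiagonal + m ≡ m * m
  offDiagonal+m = begin
    offDiagonal + m                                         ≡⟨ cong (offDiagonal +_) (sym (trans (∑-const m 1) (*-identityʳ m))) ⟩
    offDiagonal + ∑[ x < m ] 1                              ≡⟨ sym (∑-distrib-+ (λ x → ∑[ a < m ] χ (not (does (a ≟ x)))) (λ _ → 1)) ⟩
    ∑[ x < m ] (∑[ a < m ] χ (not (does (a ≟ x))) + 1)     ≡⟨ sum-cong-≗ (∑-χ-≢ {m}) ⟩
    ∑[ x < m ] m                                            ≡⟨ ∑-const m m ⟩
    m * m                                                   ∎
    where open ≡-Reasoning

  freePairs : ℕ
  freePairs = ∑[ x < m ] ∑[ a < m ] χ (free x a)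

  ∑∑capacity+freePairs : ∑[ x < m ] ∑[ a < m ] capacity x a + freePairs ≡ 2 * offDiagonal
  ∑∑capacity+freePairs = begin
    ∑[ x < m ] ∑[ a < m ] capacity x a + freePairs
      ≡⟨ sym (∑∑-distrib-+ capacity (λ x a → χ (free x a))) ⟩
    ∑[ x < m ] ∑[ a < m ] (capacity x a + χ (free x a))
      ≡⟨ sum-cong-≗ (λ x → sum-cong-≗ (capacity+free x)) ⟩
    ∑[ x < m ] ∑[ a < m ] (2 * χ (not (does (a ≟ x))))
      ≡⟨ sum-cong-≗ {m} (λ x → sym (*-distribˡ-sum 2 (λ a → χ (not (does (a ≟ x)))))) ⟩
    ∑[ x < m ] (2 * ∑[ a < m ] χ (not (does (a ≟ x))))
      ≡⟨ sym (*-distribˡ-sum 2 (λ x → ∑[ a < m ] χ (not (does (a ≟ x))))) ⟩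
    2 * offDiagonal ∎
    where open ≡-Reasoning

  #uncovered #covered : ℕ
  #uncovered = ∑[ a < m ] χ (not (covered a))
  #covered   = ∑[ a < m ] χ (covered a)

  #uncovered+#covered : #uncovered + #covered ≡ m
  #uncovered+#covered = begin
    #uncovered + #covered                         ≡⟨ sym (∑-distrib-+ (λ a → χ (not (covered a))) (λ a → χ (covered a))) ⟩
    ∑[ a < m ] (χ (not (covered a)) + χ (covered a)) ≡⟨ sum-cong-≗ (λ a → χ-not+χ (covered a)) ⟩
    ∑[ a < m ] 1                                  ≡⟨ trans (∑-const m 1) (*-identityʳ m) ⟩
    m                                             ∎
    where open ≡-Reasoning

  #covered≡2|S| : #covered ≡ 2 * countPairs S
  #covered≡2|S| = trans (sum-cong-≗ (λ x → sym (row x))) (orderedPairs≡2*countPairs S (proj₁ (proj₁ forcing)) S-irrefl)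
    where
    S⊆M : ∀ i j → S i j ≡ true → μ i ≡ j
    S⊆M = proj₂ (proj₁ forcing)
    S-irrefl : Irreflexive S
    S-irrefl i with S i i in Sii
    ... | true  = ⊥-elim (μx≢x i (S⊆M i i Sii))
    ... | false = refl
    row : ∀ x → ∑[ j < m ] χ (S x j) ≡ χ (covered x)
    row x = ∑-single (μ x) λ j j≢μx → cong χ (not-in-M j j≢μx)
      where
      not-in-M : ∀ j → j ≢ μ x → S x j ≡ false
      not-in-M j j≢μx with S x j in Sxj
      ... | true  = ⊥-elim (j≢μx (sym (S⊆M x j Sxj)))
      ... | false = refl

  private
    free-row-entry : ∀ {x} → covered x ≡ false → ∀ a →
                     χ (not (covered a)) ≡ χ (free x a) + (χ (does (a ≟ x)) + χ (does (a ≟ μ x)))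
    free-row-entry {x} cx a = by-cases (a ≟ x) (a ≟ μ x)
      where
      shape : ∀ {c f d d' c₀ f₀ e e'} → c ≡ c₀ → f ≡ f₀ → d ≡ e → d' ≡ e' →
              χ (not c₀) ≡ χ f₀ + (χ e + χ e') → χ (not c) ≡ χ f + (χ d + χ d')
      shape refl refl refl refl eq = eq
      by-cases : Dec (a ≡ x) → Dec (a ≡ μ x) → χ (not (covered a)) ≡ χ (free x a) + (χ (does (a ≟ x)) + χ (does (a ≟ μ x)))
      by-cases (yes refl) _ =
        shape cx (free-irrefl a) (dec-true (a ≟ a) refl) (dec-false (a ≟ μ a) (x≢μx a)) refl
      by-cases (no _) (yes refl) =
        shape (trans (covered-μ x) cx) (free-mate x) (dec-false (μ x ≟ x) (μx≢x x)) (dec-true (μ x ≟ μ x) refl) refl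
      by-cases (no a≢x) (no a≢μx) =
        shape refl free≡uncovered (dec-false (a ≟ x) a≢x) (dec-false (a ≟ μ x) a≢μx) (sym (+-identityʳ _))
        where
        free≡uncovered : free x a ≡ not (covered a)
        free≡uncovered rewrite cx | dec-false (a ≟ x) a≢x | dec-false (a ≟ μ x) a≢μx = ∧-identityʳ (not (covered a))

  free-row : ∀ x → ∑[ a < m ] χ (free x a) + 2 * χ (not (covered x)) ≡ χ (not (covered x)) * #uncovered
  free-row x = by-cases (covered x) refl
    where
    open ≡-Reasoning
    by-cases : ∀ c → covered x ≡ c → ∑[ a < m ] χ (free x a) + 2 * χ (not c) ≡ χ (not c) * #uncovered
    by-cases true cx = trans (+-identityʳ _) (trans (sum-cong-≗ (λ a → cong χ (covered⇒¬free a))) (trans (∑-const m 0) (*-zeroʳ m)))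
      where
      covered⇒¬free : ∀ a → free x a ≡ false
      covered⇒¬free a with free x a in free-xa
      ... | true  = ⊥-elim (covered≢uncovered cx (free-uncoveredˡ free-xa) refl)
      ... | false = refl
    by-cases false cx = sym (begin
      1 * #uncovered                                                            ≡⟨ *-identityˡ #uncovered ⟩
      #uncovered                                                                ≡⟨ sum-cong-≗ (free-row-entry cx) ⟩
      ∑[ a < m ] (χ (free x a) + (χ (does (a ≟ x)) + χ (does (a ≟ μ x))))      ≡⟨ ∑-distrib-+ (λ a → χ (free x a)) _ ⟩
      ∑[ a < m ] χ (free x a) + ∑[ a < m ] (χ (does (a ≟ x)) + χ (does (a ≟ μ x)))
        ≡⟨ cong (∑[ a < m ] χ (free x a) +_) (trans (∑-distrib-+ (λ a → χ (does (a ≟ x))) _) (cong₂ _+_ (∑-χ-≡ x) (∑-χ-≡ (μ x)))) ⟩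
      ∑[ a < m ] χ (free x a) + 2                                               ∎)

  freePairs+2#uncovered : freePairs + 2 * #uncovered ≡ #uncovered * #uncovered
  freePairs+2#uncovered = begin
    freePairs + 2 * #uncovered
      ≡⟨ cong (freePairs +_) (*-distribˡ-sum 2 (λ x → χ (not (covered x)))) ⟩
    freePairs + ∑[ x < m ] (2 * χ (not (covered x)))
      ≡⟨ sym (∑-distrib-+ (λ x → ∑[ a < m ] χ (free x a)) (λ x → 2 * χ (not (covered x)))) ⟩
    ∑[ x < m ] (∑[ a < m ] χ (free x a) + 2 * χ (not (covered x)))
      ≡⟨ sum-cong-≗ free-row ⟩
    ∑[ x < m ] (χ (not (covered x)) * #uncovered)
      ≡⟨ sum-cong-≗ (λ x → *-comm (χ (not (covered x))) #uncovered) ⟩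
    ∑[ x < m ] (#uncovered * χ (not (covered x)))
      ≡⟨ sym (*-distribˡ-sum #uncovered (λ x → χ (not (covered x)))) ⟩
    #uncovered * #uncovered ∎
    where open ≡-Reasoning

  4e+freePairs≤2offDiagonal : 4 * e G + freePairs ≤ 2 * offDiagonal
  4e+freePairs≤2offDiagonal = begin
    4 * e G + freePairs                                  ≡⟨ cong (_+ freePairs) (sym ∑∑pairWeight≡4e) ⟩
    ∑[ x < m ] ∑[ a < m ] pairWeight x a + freePairs     ≤⟨ +-monoˡ-≤ freePairs (∑-mono-≤ (λ x → ∑-mono-≤ (pairWeight≤capacity x))) ⟩
    ∑[ x < m ] ∑[ a < m ] capacity x a + freePairs       ≡⟨ ∑∑capacity+freePairs ⟩
    2 * offDiagonal                                      ∎
    where open ≤-Reasoning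

  -- p counts the matching edges of M that avoid S, and k = |S|
  module Sizes (p k : ℕ) (m≡ : m ≡ 2 * (p + k)) (|S|≡k : countPairs S ≡ k) where

    #uncovered≡2p : #uncovered ≡ 2 * p
    #uncovered≡2p = +-cancelʳ-≡ (2 * k) #uncovered (2 * p) (begin
      #uncovered + 2 * k           ≡⟨ cong (#uncovered +_) (sym (trans #covered≡2|S| (cong (2 *_) |S|≡k))) ⟩
      #uncovered + #covered        ≡⟨ #uncovered+#covered ⟩
      m                            ≡⟨ m≡ ⟩
      2 * (p + k)                  ≡⟨ *-distribˡ-+ 2 p k ⟩
      2 * p + 2 * k                ∎)
      where open ≡-Reasoning

    freePairs-value : freePairs + 2 * (2 * p) ≡ (2 * p) * (2 * p)
    freePairs-value = subst (λ w → freePairs + 2 * w ≡ w * w) #uncovered≡2p freePairs+2#uncovered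

    offDiagonal-value : offDiagonal + 2 * (p + k) ≡ (2 * (p + k)) * (2 * (p + k))
    offDiagonal-value = subst (λ n → offDiagonal + n ≡ n * n) m≡ offDiagonal+m

    edge-bound : e G + (k * k + k) ≤ (p + k) * (p + k) + 2 * (p + k) * k
    edge-bound = edge-bound-arithmetic (e G) p k offDiagonal freePairs freePairs-value offDiagonal-value
                   4e+freePairs≤2offDiagonal

    pairWeight≡capacity : e G + (k * k + k) ≡ (p + k) * (p + k) + 2 * (p + k) * k → ∀ x a → pairWeight x a ≡ capacity x a
    pairWeight≡capacity e≡ x a = ∑-mono-≤-tight (pairWeight≤capacity x) (≤-reflexive (sym (row-sums-equal x))) a
      where
      ∑∑≡ : ∑[ x < m ] ∑[ a < m ] capacity x a ≡ ∑[ x < m ] ∑[ a < m ] pairWeight x a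
      ∑∑≡ = +-cancelʳ-≡ freePairs _ _ (begin
        ∑[ x < m ] ∑[ a < m ] capacity x a + freePairs   ≡⟨ ∑∑capacity+freePairs ⟩
        2 * offDiagonal
          ≡⟨ sym (edge-equality-arithmetic (e G) p k offDiagonal freePairs freePairs-value offDiagonal-value e≡) ⟩
        4 * e G + freePairs                              ≡⟨ cong (_+ freePairs) (sym ∑∑pairWeight≡4e) ⟩
        ∑[ x < m ] ∑[ a < m ] pairWeight x a + freePairs ∎)
        where open ≡-Reasoning
      row-sums-equal : ∀ x → ∑[ a < m ] pairWeight x a ≡ ∑[ a < m ] capacity x a
      row-sums-equal = ∑-mono-≤-tight (λ x → ∑-mono-≤ (pairWeight≤capacity x)) (≤-reflexive ∑∑≡)

    module Extremal (e≡ : e G + (k * k + k) ≡ (p + k) * (p + k) + 2 * (p + k) * k) where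

      covered-adjacent : ∀ x a → a ≢ x → covered x ≡ true ⊎ covered a ≡ true → A x a ≡ true
      covered-adjacent x a a≢x covered-x-or-a =
        χ+χ≡2 (A x a) (A (μ x) (μ a)) (trans (pairWeight≡capacity e≡ x a)
          (cong₂ (λ d f → χ (not d) + χ (not d ∧ not f)) (dec-false (a ≟ x) a≢x) (not-free covered-x-or-a)))
        where
        not-free : covered x ≡ true ⊎ covered a ≡ true → free x a ≡ false
        not-free cx⊎ca with free x a in free-xa
        ... | false = refl
        ... | true with cx⊎ca
        ...   | inj₁ cx = ⊥-elim (true≢false cx (free-uncoveredˡ free-xa))
        ...   | inj₂ ca = ⊥-elim (true≢false ca (free-uncoveredʳ free-xa))

      free⇒exactly-one : ∀ {x a} → Free x a → A (μ x) (μ a) ≡ not (A x a)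
      free⇒exactly-one {x} {a} free-xa = χ+χ≡1 (A x a) (A (μ x) (μ a)) (trans (pairWeight≡capacity e≡ x a)
        (cong₂ (λ d f → χ (not d) + χ (not d ∧ not f)) (dec-false (a ≟ x) (free-≢ free-xa)) free-xa))

      Dominates : Fin m → Fin m → Set
      Dominates z x = Free x z × A z x ≡ true × A z (μ x) ≡ true

      dominates-μ : ∀ {z x} → Dominates z x → Dominates z (μ x)
      dominates-μ {z} {x} (free-xz , Azx , Azμx) = free-μˡ free-xz , Azμx , trans (cong (A z) (μ-involutive x)) Azx

      dominates-μ⁻¹ : ∀ {z x} → Dominates z (μ x) → Dominates z x
      dominates-μ⁻¹ {z} {x} d = subst (Dominates z) (μ-involutive x) (dominates-μ d)

      comparable : ∀ {z y} → Free z y → Dominates z y ⊎ Dominates (μ z) y ⊎ Dominates y z ⊎ Dominates (μ y) z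
      comparable {z} {y} free-zy = by-cases (A z y) refl (A z (μ y)) refl
        where
        Aμzμy : A (μ z) (μ y) ≡ not (A z y)
        Aμzμy = free⇒exactly-one free-zy
        Aμzy : A (μ z) y ≡ not (A z (μ y))
        Aμzy = trans (sym (cong (A (μ z)) (μ-involutive y))) (free⇒exactly-one (free-μʳ free-zy))
        by-cases : ∀ α → A z y ≡ α → ∀ β → A z (μ y) ≡ β →
                   Dominates z y ⊎ Dominates (μ z) y ⊎ Dominates y z ⊎ Dominates (μ y) z
        by-cases true  Azy true  Azμy = inj₁ (free-sym free-zy , Azy , Azμy)
        by-cases false Azy false Azμy =
          inj₂ (inj₁ (free-sym (free-μˡ free-zy) , trans Aμzy (cong not Azμy) , trans Aμzμy (cong not Azy)))
        by-cases true  Azy false Azμy =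
          inj₂ (inj₂ (inj₁ (free-zy , trans (adj-sym G y z) Azy , trans (adj-sym G y (μ z)) (trans Aμzy (cong not Azμy)))))
        by-cases false Azy true  Azμy =
          inj₂ (inj₂ (inj₂ (free-μʳ free-zy , trans (adj-sym G (μ y) z) Azμy ,
                             trans (adj-sym G (μ y) (μ z)) (trans Aμzμy (cong not Azy)))))

      not-dominated-by-both-ends : ∀ {z x} → Dominates z x → Dominates (μ z) x → ⊥
      not-dominated-by-both-ends {z} {x} (free-xz , Azx , _) (_ , _ , Aμzμx) =
        true≢false Aμzμx (trans (free⇒exactly-one (free-sym free-xz)) (cong not Azx))

      dominates-asym : ∀ {x y} → Dominates x y → Dominates y x → ⊥
      dominates-asym {x} {y} (free-yx , _ , Axμy) (_ , _ , Ayμx) =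
        true≢false (trans (adj-sym G (μ x) y) Ayμx)
          (trans (sym (cong (A (μ x)) (μ-involutive y))) (trans (free⇒exactly-one (free-μʳ (free-sym free-yx))) (cong not Axμy)))

      dominates-asym-μ : ∀ {x y} → Dominates x y → Dominates (μ y) x → ⊥
      dominates-asym-μ {x} {y} (free-yx , Axy , _) (_ , _ , Aμyμx) =
        true≢false (trans (adj-sym G (μ x) (μ y)) Aμyμx) (trans (free⇒exactly-one (free-sym free-yx)) (cong not Axy))

      no-dominating-3-cycle : ∀ {a b c} → Dominates a b → Dominates b c → Dominates c a → ⊥
      no-dominating-3-cycle (free-ba , _ , Aaμb) (free-cb , _ , Abμc) (free-ac , _ , Acμa) =
        no-alternating-6-cycle (free-sym free-ba) (free-sym free-cb) (free-sym free-ac) Aaμb Abμc Acμa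

      mates-not-both-dominating : ∀ {x y z} → Dominates x y → Dominates (μ x) z → ⊥
      mates-not-both-dominating {x} {y} {z} d₁ d₂ = by-cases (z ≟ y) (z ≟ μ y)
        where
        free-yx = proj₁ d₁
        free-zμx = proj₁ d₂
        free-zx : Free z x
        free-zx = subst (Free z) (μ-involutive x) (free-μʳ free-zμx)
        Axμy = proj₂ (proj₂ d₁)
        by-edge : Free y z → ∀ α → A y z ≡ α → ⊥
        by-edge free-yz true Ayz =
          no-alternating-6-cycle (free-sym free-yx) (free-μʳ free-yz) (free-μˡ free-zx)
            Axμy (trans (cong (A y) (μ-involutive z)) Ayz) (trans (adj-sym G (μ z) (μ x)) (proj₂ (proj₂ d₂)))
        by-edge free-yz false Ayz =
          no-alternating-6-cycle (free-μʳ (free-sym free-yx)) (free-μˡ free-yz) free-zx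
            (trans (cong (A x) (μ-involutive y)) (proj₁ (proj₂ d₁)))
            (trans (free⇒exactly-one free-yz) (cong not Ayz)) (trans (adj-sym G z (μ x)) (proj₁ (proj₂ d₂)))
        by-cases : Dec (z ≡ y) → Dec (z ≡ μ y) → ⊥
        by-cases (yes refl) _ = not-dominated-by-both-ends d₁ d₂
        by-cases (no _) (yes refl) = not-dominated-by-both-ends d₁ (dominates-μ⁻¹ d₂)
        by-cases (no z≢y) (no z≢μy) =
          by-edge (⇒free (free-uncoveredˡ free-yx) (free-uncoveredˡ free-zμx) z≢y z≢μy) (A y z) refl

      dominates-trans : ∀ {z x y} → Dominates z x → Dominates x y → Dominates z y
      dominates-trans {z} {x} {y} d₁ d₂ = by-cases (z ≟ y) (z ≟ μ y)
        where
        by-comparison : Dominates z y ⊎ Dominates (μ z) y ⊎ Dominates y z ⊎ Dominates (μ y) z → Dominates z y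
        by-comparison (inj₁ d) = d
        by-comparison (inj₂ (inj₁ d)) = ⊥-elim (mates-not-both-dominating d₁ d)
        by-comparison (inj₂ (inj₂ (inj₁ d))) = ⊥-elim (no-dominating-3-cycle d₁ d₂ d)
        by-comparison (inj₂ (inj₂ (inj₂ d))) = ⊥-elim (no-dominating-3-cycle d₁ (dominates-μ d₂) d)
        by-cases : Dec (z ≡ y) → Dec (z ≡ μ y) → Dominates z y
        by-cases (yes refl) _ = ⊥-elim (dominates-asym d₂ d₁)
        by-cases (no _) (yes refl) = ⊥-elim (dominates-asym-μ d₂ d₁)
        by-cases (no z≢y) (no z≢μy) = by-comparison (comparable
          (⇒free (free-uncoveredʳ (proj₁ d₁)) (free-uncoveredˡ (proj₁ d₂)) (≢-sym z≢y) (≢-sym (≢μ⇒μ≢ z≢μy))))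

      dominates? : Fin m → Fin m → Bool
      dominates? z x = free x z ∧ A z x ∧ A z (μ x)

      dominates?⇒ : ∀ {z x} → dominates? z x ≡ true → Dominates z x
      dominates?⇒ = ∧₃-true⇒

      ⇒dominates? : ∀ {z x} → Dominates z x → dominates? z x ≡ true
      ⇒dominates? (free-xz , Azx , Azμx) = ⇒∧₃-true free-xz Azx Azμx

      rank : Fin m → ℕ
      rank x = ∑[ z < m ] χ (dominates? z x)

      rank-μ : ∀ x → rank (μ x) ≡ rank x
      rank-μ x = sum-cong-≗ {m} λ z → cong χ (⇔→≡ {z = true} (mk⇔
        (λ d → ⇒dominates? (dominates-μ⁻¹ (dominates?⇒ d)))
        (λ d → ⇒dominates? (dominates-μ (dominates?⇒ d)))))

      dominates⇒rank< : ∀ {x y} → Dominates x y → rank x < rank y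
      dominates⇒rank< {x} {y} x▷y = subst (_≤ rank y) rank+1 (∑-mono-≤ pointwise)
        where
        rank+1 : ∑[ z < m ] (χ (dominates? z x) + χ (does (z ≟ x))) ≡ suc (rank x)
        rank+1 = trans (∑-distrib-+ (λ z → χ (dominates? z x)) (λ z → χ (does (z ≟ x))))
                       (trans (cong (rank x +_) (∑-χ-≡ x)) (+-comm (rank x) 1))
        pointwise : ∀ z → χ (dominates? z x) + χ (does (z ≟ x)) ≤ χ (dominates? z y)
        pointwise z = χ+χ≤χ _ _ _
          (λ z▷x → ⇒dominates? (dominates-trans (dominates?⇒ z▷x) x▷y))
          (λ z≡x → subst (λ v → dominates? v y ≡ true) (sym (does-true⇒ (z ≟ x) z≡x)) (⇒dominates? x▷y))
          (λ z▷x z≡x → free-≢ (proj₁ (dominates?⇒ z▷x)) (does-true⇒ (z ≟ x) z≡x))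

      -- a free edge is dominated by at most one end of each of the other p - 1 free edges
      rank<p : ∀ {x} → covered x ≡ false → rank x < p
      rank<p {x} cx = *-cancelˡ-≤ 2 (begin
        2 * suc (rank x)                                      ≡⟨ double-suc (rank x) ⟩
        rank x + rank x + 2                                   ≡⟨ cong (λ r → rank x + r + 2) (∑-permute (λ z → χ (dominates? z x)) μ-permutation) ⟩
        rank x + ∑[ z < m ] χ (dominates? (μ z) x) + 2        ≡⟨ cong (_+ 2) (sym (∑-distrib-+ (λ z → χ (dominates? z x)) _)) ⟩
        ∑[ z < m ] (χ (dominates? z x) + χ (dominates? (μ z) x)) + 2 ≤⟨ +-monoˡ-≤ 2 (∑-mono-≤ pointwise) ⟩
        ∑[ z < m ] χ (free x z) + 2                           ≡⟨ subst (λ c → ∑[ a < m ] χ (free x a) + 2 * χ (not c) ≡ χ (not c) * #uncovered) cx (free-row x) ⟩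
        1 * #uncovered                                        ≡⟨ trans (*-identityˡ #uncovered) #uncovered≡2p ⟩
        2 * p                                                 ∎)
        where
        open ≤-Reasoning
        double-suc : ∀ r → 2 * suc r ≡ r + r + 2
        double-suc = solve-∀
        pointwise : ∀ z → χ (dominates? z x) + χ (dominates? (μ z) x) ≤ χ (free x z)
        pointwise z = χ+χ≤χ _ _ _
          (λ z▷x → proj₁ (dominates?⇒ z▷x))
          (λ μz▷x → subst (λ v → Free x v) (μ-involutive z) (free-μʳ (proj₁ (dominates?⇒ μz▷x))))
          (λ z▷x μz▷x → not-dominated-by-both-ends (dominates?⇒ z▷x) (dominates?⇒ μz▷x))

      free⇒rank≢ : ∀ {x y} → Free x y → rank x ≢ rank y
      free⇒rank≢ {x} {y} free-xy rx≡ry with comparable free-xy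
      ... | inj₁ d = <-irrefl rx≡ry (dominates⇒rank< d)
      ... | inj₂ (inj₁ d) = <-irrefl (trans (rank-μ x) rx≡ry) (dominates⇒rank< d)
      ... | inj₂ (inj₂ (inj₁ d)) = <-irrefl (sym rx≡ry) (dominates⇒rank< d)
      ... | inj₂ (inj₂ (inj₂ d)) = <-irrefl (trans (rank-μ y) (sym rx≡ry)) (dominates⇒rank< d)

      dominatesSome : Fin m → Bool
      dominatesSome x = 0 <ᵇ ∑[ z < m ] χ (dominates? x z)

      dominatesSome-intro : ∀ {x z} → Dominates x z → dominatesSome x ≡ true
      dominatesSome-intro {x} {z} d =
        <ᵇ-true (≤-trans (≤-reflexive (sym (cong χ (⇒dominates? d)))) (term≤∑ (λ v → χ (dominates? x v)) z))

      dominatesSome-elim : ∀ {x} → dominatesSome x ≡ true → ∃ λ z → Dominates x z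
      dominatesSome-elim {x} some with ∑-positive (λ v → χ (dominates? x v)) (<ᵇ-true⇒< some)
      ... | z , positive = z , dominates?⇒ (χ-positive _ positive)

      -- whether x is sent to the clique side V of Ĥ_{p,0}; if neither end of the
      -- edge {x, μ x} dominates anything, the end of smaller index is chosen
      upper : Fin m → Bool
      upper x = if dominatesSome x then true else if dominatesSome (μ x) then false else toℕ x <ᵇ toℕ (μ x)

      upper-μ : ∀ x → upper (μ x) ≡ not (upper x)
      upper-μ x = trans (cong (λ v → if dominatesSome (μ x) then true else if dominatesSome v then false else toℕ (μ x) <ᵇ toℕ v)
                              (μ-involutive x))
                        (by-cases (dominatesSome x) (dominatesSome (μ x)) exclusive (<ᵇ-flip (x≢μx x)))
        where
        exclusive : dominatesSome x ≡ true → dominatesSome (μ x) ≡ true → ⊥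
        exclusive some-x some-μx =
          mates-not-both-dominating (proj₂ (dominatesSome-elim some-x)) (proj₂ (dominatesSome-elim some-μx))
        <ᵇ-flip : ∀ {u v : Fin m} → u ≢ v → (toℕ v <ᵇ toℕ u) ≡ not (toℕ u <ᵇ toℕ v)
        <ᵇ-flip {u} {v} u≢v with <-cmp (toℕ u) (toℕ v)
        ... | tri< u<v _ _ rewrite <ᵇ-true u<v | <ᵇ-false (<⇒≤ u<v) = refl
        ... | tri≈ _ u≡v _ = ⊥-elim (u≢v (toℕ-injective u≡v))
        ... | tri> _ _ u>v rewrite <ᵇ-true u>v | <ᵇ-false (<⇒≤ u>v) = refl
        by-cases : ∀ d d′ {l l′} → (d ≡ true → d′ ≡ true → ⊥) → l′ ≡ not l →
                   (if d′ then true else if d then false else l′) ≡ not (if d then true else if d′ then false else l)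
        by-cases true  true  excl _ = ⊥-elim (excl refl refl)
        by-cases true  false _ _ = refl
        by-cases false true  _ _ = refl
        by-cases false false _ l′≡ = l′≡

      dominates⇒upper : ∀ {z y} → Dominates z y → upper z ≡ true
      dominates⇒upper {z} d = cong (λ s → if s then true else if dominatesSome (μ z) then false else toℕ z <ᵇ toℕ (μ z))
                                   (dominatesSome-intro d)

      dominates⇒lower : ∀ {z y} → Dominates (μ z) y → upper z ≡ false
      dominates⇒lower {z} d = trans (sym (trans (cong not (upper-μ z)) (not-involutive (upper z)))) (cong not (dominates⇒upper d))

      coveredIndex : Fin m → ℕ
      coveredIndex x = ∑[ z < m ] χ (covered z ∧ (toℕ z <ᵇ toℕ x))

      private
        coveredIndex<∑ : ∀ x (c : Fin m → Bool) → c x ≡ true → (∀ z → covered z ≡ true → toℕ z < toℕ x → c z ≡ true) →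
                         coveredIndex x < ∑[ z < m ] χ (c z)
        coveredIndex<∑ x c cx below⇒c = subst (_≤ ∑[ z < m ] χ (c z)) index+1 (∑-mono-≤ pointwise)
          where
          index+1 : ∑[ z < m ] (χ (covered z ∧ (toℕ z <ᵇ toℕ x)) + χ (does (z ≟ x))) ≡ suc (coveredIndex x)
          index+1 = trans (∑-distrib-+ (λ z → χ (covered z ∧ (toℕ z <ᵇ toℕ x))) (λ z → χ (does (z ≟ x))))
                          (trans (cong (coveredIndex x +_) (∑-χ-≡ x)) (+-comm (coveredIndex x) 1))
          pointwise : ∀ z → χ (covered z ∧ (toℕ z <ᵇ toℕ x)) + χ (does (z ≟ x)) ≤ χ (c z)
          pointwise z = χ+χ≤χ (covered z ∧ (toℕ z <ᵇ toℕ x)) (does (z ≟ x)) (c z)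
            (λ below → below⇒c z (∧-trueˡ below) (<ᵇ-true⇒< (∧-trueʳ below)))
            (λ z≡x → subst (λ v → c v ≡ true) (sym (does-true⇒ (z ≟ x) z≡x)) cx)
            (λ below z≡x → <-irrefl (cong toℕ (does-true⇒ (z ≟ x) z≡x)) (<ᵇ-true⇒< (∧-trueʳ {covered z} below)))

      coveredIndex<2k : ∀ {x} → covered x ≡ true → coveredIndex x < 2 * k
      coveredIndex<2k {x} cx = subst (coveredIndex x <_) (trans #covered≡2|S| (cong (2 *_) |S|≡k))
                                 (coveredIndex<∑ x covered cx (λ z cz _ → cz))

      coveredIndex-increasing : ∀ {x y} → covered x ≡ true → toℕ x < toℕ y → coveredIndex x < coveredIndex y
      coveredIndex-increasing {x} {y} cx x<y = coveredIndex<∑ x (λ z → covered z ∧ (toℕ z <ᵇ toℕ y)) (⇒∧-true cx (<ᵇ-true x<y))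
        (λ z cz z<x → ⇒∧-true cz (<ᵇ-true (<-trans z<x x<y)))

      coveredIndex-injective : ∀ {x y} → covered x ≡ true → covered y ≡ true → coveredIndex x ≡ coveredIndex y → x ≡ y
      coveredIndex-injective {x} {y} cx cy same with <-cmp (toℕ x) (toℕ y)
      ... | tri< x<y _ _ = ⊥-elim (<-irrefl same (coveredIndex-increasing cx x<y))
      ... | tri≈ _ x≡y _ = toℕ-injective x≡y
      ... | tri> _ _ x>y = ⊥-elim (<-irrefl (sym same) (coveredIndex-increasing cy x>y))

      -- In Ĥ_{p,0} the edge u_r v_r is dominated exactly by v_0, …, v_{r-1}, so ranks are indices there.
      label : Fin m → ℕ
      label x = if covered x then p + p + coveredIndex x else if upper x then p + rank x else rank x

      label-covered : ∀ {x} → covered x ≡ true → label x ≡ p + p + coveredIndex x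
      label-covered {x} cx rewrite cx = refl

      label-lower : ∀ {x} → covered x ≡ false → upper x ≡ false → label x ≡ rank x
      label-lower {x} cx ux rewrite cx | ux = refl

      label-upper : ∀ {x} → covered x ≡ false → upper x ≡ true → label x ≡ p + rank x
      label-upper {x} cx ux rewrite cx | ux = refl

      2p≤label : ∀ {x} → covered x ≡ true → p + p ≤ label x
      2p≤label {x} cx = subst (p + p ≤_) (sym (label-covered cx)) (m≤m+n (p + p) (coveredIndex x))

      label<2p : ∀ {x} → covered x ≡ false → label x < p + p
      label<2p {x} cx = by-side (upper x) refl
        where
        by-side : ∀ u → upper x ≡ u → label x < p + p
        by-side true  ux = subst (_< p + p) (sym (label-upper cx ux)) (+-monoʳ-< p (rank<p cx))
        by-side false ux = subst (_< p + p) (sym (label-lower cx ux)) (<-≤-trans (rank<p cx) (m≤m+n p p))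

      label<2p+2k : ∀ x → label x < p + p + 2 * k
      label<2p+2k x = by-cover (covered x) refl
        where
        by-cover : ∀ c → covered x ≡ c → label x < p + p + 2 * k
        by-cover true  cx = subst (_< p + p + 2 * k) (sym (label-covered cx)) (+-monoʳ-< (p + p) (coveredIndex<2k cx))
        by-cover false cx = <-≤-trans (label<2p cx) (m≤m+n (p + p) (2 * k))

      private
        uncovered-label-injective : ∀ {x y} → covered x ≡ false → covered y ≡ false →
                                    upper x ≡ upper y → rank x ≡ rank y → x ≡ y
        uncovered-label-injective {x} {y} cx cy same-side same-rank = by-cases (y ≟ x) (y ≟ μ x)
          where
          by-cases : Dec (y ≡ x) → Dec (y ≡ μ x) → x ≡ y
          by-cases (yes y≡x) _ = sym y≡x
          by-cases (no _) (yes refl) = ⊥-elim (not-fixed (upper x) (trans same-side (upper-μ x)))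
            where
            not-fixed : ∀ b → b ≢ not b
            not-fixed true  ()
            not-fixed false ()
          by-cases (no y≢x) (no y≢μx) = ⊥-elim (free⇒rank≢ (⇒free cx cy y≢x y≢μx) same-rank)

      label-injective : ∀ x y → label x ≡ label y → x ≡ y
      label-injective x y same = by-cover (covered x) refl (covered y) refl
        where
        by-side : covered x ≡ false → covered y ≡ false → ∀ u → upper x ≡ u → ∀ v → upper y ≡ v → x ≡ y
        by-side cx cy true ux true uy = uncovered-label-injective cx cy (trans ux (sym uy))
          (+-cancelˡ-≡ p _ _ (trans (sym (label-upper cx ux)) (trans same (label-upper cy uy))))
        by-side cx cy false ux false uy = uncovered-label-injective cx cy (trans ux (sym uy))
          (trans (sym (label-lower cx ux)) (trans same (label-lower cy uy)))
        by-side cx cy true ux false uy = ⊥-elim (<⇒≱ (rank<p cy)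
          (subst (p ≤_) (trans (sym (label-upper cx ux)) (trans same (label-lower cy uy))) (m≤m+n p (rank x))))
        by-side cx cy false ux true uy = ⊥-elim (<⇒≱ (rank<p cx)
          (subst (p ≤_) (trans (sym (label-upper cy uy)) (trans (sym same) (label-lower cx ux))) (m≤m+n p (rank y))))
        by-cover : ∀ c → covered x ≡ c → ∀ d → covered y ≡ d → x ≡ y
        by-cover true cx true cy = coveredIndex-injective cx cy
          (+-cancelˡ-≡ (p + p) _ _ (trans (sym (label-covered cx)) (trans same (label-covered cy))))
        by-cover true cx false cy = ⊥-elim (<⇒≱ (label<2p cy) (subst (p + p ≤_) same (2p≤label cx)))
        by-cover false cx true cy = ⊥-elim (<⇒≱ (label<2p cx) (subst (p + p ≤_) (sym same) (2p≤label cy)))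
        by-cover false cx false cy = by-side cx cy (upper x) refl (upper y) refl

      private
        uncovered-labels : ∀ {x y} → covered x ≡ false → covered y ≡ false → ∀ u → upper x ≡ u → ∀ v → upper y ≡ v →
          extremalAdj p (label x) (label y) ≡
          (if u then (if v then not (rank x ≡ᵇ rank y) else rank x ≤ᵇ rank y)
                else (if v then rank y ≤ᵇ rank x else false))
        uncovered-labels {x} {y} cx cy true ux true uy =
          trans (cong₂ (extremalAdj p) (label-upper cx ux) (label-upper cy uy)) (extremalAdj-VV (rank<p cx) (rank<p cy))
        uncovered-labels {x} {y} cx cy true ux false uy =
          trans (cong₂ (extremalAdj p) (label-upper cx ux) (label-lower cy uy)) (extremalAdj-VU (rank<p cx) (rank<p cy))
        uncovered-labels {x} {y} cx cy false ux true uy =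
          trans (cong₂ (extremalAdj p) (label-lower cx ux) (label-upper cy uy)) (extremalAdj-UV (rank<p cx) (rank<p cy))
        uncovered-labels {x} {y} cx cy false ux false uy =
          trans (cong₂ (extremalAdj p) (label-lower cx ux) (label-lower cy uy)) (extremalAdj-UU (rank<p cx) (rank<p cy))

        dominates⇒adj≡ : ∀ {x y} → covered x ≡ false → covered y ≡ false → Dominates x y →
                         A x y ≡ extremalAdj p (label x) (label y)
        dominates⇒adj≡ {x} {y} cx cy x▷y = trans (proj₁ (proj₂ x▷y)) (sym (by-side (upper y) refl))
          where
          rx<ry = dominates⇒rank< x▷y
          by-side : ∀ v → upper y ≡ v → extremalAdj p (label x) (label y) ≡ true
          by-side true  uy = trans (uncovered-labels cx cy true (dominates⇒upper x▷y) true uy) (cong not (≡ᵇ-false (<⇒≢ rx<ry)))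
          by-side false uy = trans (uncovered-labels cx cy true (dominates⇒upper x▷y) false uy) (≤ᵇ-true (<⇒≤ rx<ry))

        mate-dominates⇒adj≡ : ∀ {x y} → covered x ≡ false → covered y ≡ false → Dominates (μ x) y →
                              A x y ≡ extremalAdj p (label x) (label y)
        mate-dominates⇒adj≡ {x} {y} cx cy μx▷y = trans Axy≡false (sym (by-side (upper y) refl))
          where
          rx<ry : rank x < rank y
          rx<ry = subst (_< rank y) (rank-μ x) (dominates⇒rank< μx▷y)
          Axy≡false : A x y ≡ false
          Axy≡false = trans (sym (not-involutive (A x y)))
            (cong not (trans (sym (free⇒exactly-one (free-sym (subst (Free y) (μ-involutive x) (free-μʳ (proj₁ μx▷y))))))
                             (proj₂ (proj₂ μx▷y))))
          by-side : ∀ v → upper y ≡ v → extremalAdj p (label x) (label y) ≡ false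
          by-side true  uy = trans (uncovered-labels cx cy false (dominates⇒lower μx▷y) true uy) (≤ᵇ-false rx<ry)
          by-side false uy = uncovered-labels cx cy false (dominates⇒lower μx▷y) false uy

        uncovered⇒adj≡ : ∀ {x y} → covered x ≡ false → covered y ≡ false → A x y ≡ extremalAdj p (label x) (label y)
        uncovered⇒adj≡ {x} {y} cx cy = by-cases (y ≟ x) (y ≟ μ x)
          where
          cμx = trans (covered-μ x) cx
          diagonal : ∀ u → upper x ≡ u → false ≡ extremalAdj p (label x) (label x)
          diagonal true  ux = sym (trans (uncovered-labels cx cx true ux true ux) (cong not (≡ᵇ-refl (rank x))))
          diagonal false ux = sym (uncovered-labels cx cx false ux false ux)
          mates : ∀ u → upper x ≡ u → true ≡ extremalAdj p (label x) (label (μ x))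
          mates true  ux = sym (trans (uncovered-labels cx cμx true ux false (trans (upper-μ x) (cong not ux)))
                                      (≤ᵇ-true (≤-reflexive (sym (rank-μ x)))))
          mates false ux = sym (trans (uncovered-labels cx cμx false ux true (trans (upper-μ x) (cong not ux)))
                                      (≤ᵇ-true (≤-reflexive (rank-μ x))))
          flipped : A y x ≡ extremalAdj p (label y) (label x) → A x y ≡ extremalAdj p (label x) (label y)
          flipped eq = trans (adj-sym G x y) (trans eq (extremalAdj-sym {p} (label y) (label x)))
          by-comparison : Dominates x y ⊎ Dominates (μ x) y ⊎ Dominates y x ⊎ Dominates (μ y) x →
                          A x y ≡ extremalAdj p (label x) (label y)
          by-comparison (inj₁ d) = dominates⇒adj≡ cx cy d
          by-comparison (inj₂ (inj₁ d)) = mate-dominates⇒adj≡ cx cy d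
          by-comparison (inj₂ (inj₂ (inj₁ d))) = flipped (dominates⇒adj≡ cy cx d)
          by-comparison (inj₂ (inj₂ (inj₂ d))) = flipped (mate-dominates⇒adj≡ cy cx d)
          by-cases : Dec (y ≡ x) → Dec (y ≡ μ x) → A x y ≡ extremalAdj p (label x) (label y)
          by-cases (yes refl) _ = trans (adj-irrefl G x) (diagonal (upper x) refl)
          by-cases (no _) (yes refl) = trans (μ-adj x) (mates (upper x) refl)
          by-cases (no y≢x) (no y≢μx) = by-comparison (comparable (⇒free cx cy y≢x y≢μx))

      adj≡extremalAdj-label : ∀ x y → A x y ≡ extremalAdj p (label x) (label y)
      adj≡extremalAdj-label x y = by-cover (covered x) refl (covered y) refl
        where
        by-cover : ∀ c → covered x ≡ c → ∀ d → covered y ≡ d → A x y ≡ extremalAdj p (label x) (label y)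
        by-cover true cx true cy with x ≟ y
        ... | yes refl = trans (adj-irrefl G x)
                           (sym (trans (extremalAdj-KK {p} (2p≤label cx) (2p≤label cx)) (cong not (≡ᵇ-refl (label x)))))
        ... | no x≢y = trans (covered-adjacent x y (≢-sym x≢y) (inj₁ cx))
                         (sym (trans (extremalAdj-KK {p} (2p≤label cx) (2p≤label cy))
                                     (cong not (≡ᵇ-false (λ same → x≢y (label-injective x y same))))))
        by-cover true cx false cy = trans (covered-adjacent x y (≢-sym (covered≢uncovered cx cy)) (inj₁ cx))
                                          (sym (extremalAdj-KH {p} (2p≤label cx) (label<2p cy)))
        by-cover false cx true cy = trans (covered-adjacent x y (covered≢uncovered cy cx) (inj₂ cy))
                                          (sym (extremalAdj-HK {p} (label<2p cx) (2p≤label cy)))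
        by-cover false cx false cy = uncovered⇒adj≡ cx cy

      ≅extremal : G ≅ (hatH p ∨ᵍ complete (2 * k))
      ≅extremal = bijection , λ x y →
        trans (adj≡extremalAdj-label x y)
              (sym (trans (join-adj≡extremalAdj p (2 * k) (φ x) (φ y)) (cong₂ (extremalAdj p) (toℕ-fromℕ< _) (toℕ-fromℕ< _))))
        where
        φ : Fin m → Fin (p + p + 2 * k)
        φ x = fromℕ< (label<2p+2k x)
        φ-injective : ∀ {x y} → φ x ≡ φ y → x ≡ y
        φ-injective {x} {y} φx≡φy =
          label-injective x y (trans (sym (toℕ-fromℕ< _)) (trans (cong toℕ φx≡φy) (toℕ-fromℕ< _)))
        sizes : m ≡ p + p + 2 * k
        sizes = trans m≡ (regroup p k)
          where
          regroup : ∀ p k → 2 * (p + k) ≡ p + p + 2 * k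
          regroup = solve-∀
        bijection : Bijection (setoid (Fin m)) (setoid (Fin (p + p + 2 * k)))
        bijection = record
          { to        = φ
          ; cong      = cong φ
          ; bijective = φ-injective , λ y → let x , φx≡y = injective⇒surjective sizes φ φ-injective y in x , λ { refl → φx≡y }
          }

theorem2p1 : (n k : ℕ) (G : Graph (2 * n)) → HasPerfectMatching G →
    MinForcingNumber G k → k < n →
    (e G ≤ n * n + 2 * n * k ∸ (k * k + k)) ×
    ((e G ≡ n * n + 2 * n * k ∸ (k * k + k)) ⇔ (G ≅ extremal n k))
theorem2p1 n k G _ ((M , S , forcing , |S|≡k) , _) k<n = bound , mk⇔ extremal-if-tight tight-if-extremal
  where
  p = n ∸ k
  p+k≡n : p + k ≡ n
  p+k≡n = m∸n+n≡m (<⇒≤ k<n)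
  open ForcingSet G M S forcing
  open Sizes p k (cong (2 *_) (sym p+k≡n)) |S|≡k
  target≡ : n * n + 2 * n * k ≡ (p + k) * (p + k) + 2 * (p + k) * k
  target≡ = cong (λ v → v * v + 2 * v * k) (sym p+k≡n)
  bound : e G ≤ n * n + 2 * n * k ∸ (k * k + k)
  bound = subst (λ t → e G ≤ t ∸ (k * k + k)) (sym target≡) (m+n≤o⇒m≤o∸n (e G) edge-bound)
  extremal-if-tight : e G ≡ n * n + 2 * n * k ∸ (k * k + k) → G ≅ extremal n k
  extremal-if-tight e≡ = Extremal.≅extremal (begin
    e G + (k * k + k)                                              ≡⟨ cong (_+ (k * k + k)) (trans e≡ (cong (_∸ (k * k + k)) target≡)) ⟩
    (p + k) * (p + k) + 2 * (p + k) * k ∸ (k * k + k) + (k * k + k) ≡⟨ m∸n+n≡m (≤-trans (m≤n+m (k * k + k) (e G)) edge-bound) ⟩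
    (p + k) * (p + k) + 2 * (p + k) * k                            ∎)
    where open ≡-Reasoning
  tight-if-extremal : G ≅ extremal n k → e G ≡ n * n + 2 * n * k ∸ (k * k + k)
  tight-if-extremal G≅ = begin
    e G                                                    ≡⟨ ≅⇒e≡ G (extremal n k) G≅ ⟩
    e (extremal n k)                                       ≡⟨ sym (m+n∸n≡m _ (k * k + k)) ⟩
    e (extremal n k) + (k * k + k) ∸ (k * k + k)           ≡⟨ cong (_∸ (k * k + k)) (trans (e-extremal p k) (sym target≡)) ⟩
    n * n + 2 * n * k ∸ (k * k + k)                        ∎
    where open ≡-Reasoning
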